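{- For every positive integer $k$, \[\sum_{n=1}^\infty\frac{H_n}{n(n+k)}=\frac1k\left(\frac12H_k^2+\frac12H_k^{(2)}+\zeta(2)-\frac{H_k}{k}\right),\] \[\sum_{n=1}^\infty\frac{H_n^2-H_n^{(2)}}{n(n+k)}=\frac1k\left\{2\zeta(3)+\frac{H_k^3+3H_kH_k^{(2)}+2H_k^{(3)}}{3}-\frac{H_k^2+H_k^{(2)}}{k}\right\},\] \[\sum_{n=1}^\infty\frac{H_n^3-3H_nH_n^{(2)}+2H_n^{(3)}}{n(n+k)}=\frac1k\left\{\frac{H_k^4+8H_kH_k^{(3)}+6H_k^2H_k^{(2)}+3\left(H_k^{(2)}\right)^2+6H_k^{(4)}}{4}-\frac{H_k^3+3H_kH_k^{(2)}+2H_k^{(3)}}{k}+6\zeta(4)\right\}.\]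
   Context: For integers $j\ge1$, $N\ge0$, $H_N^{(j)}=\sum_{i=1}^N i^{ -j}$ and $H_N=H_N^{(1)}$. $\zeta$ denotes the Riemann zeta function, $\zeta(s)=\sum_{n\ge1}n^{ -s}$. -}

module Defs where

open import Data.Nat using (ℕ; zero; suc)
import Data.Nat as ℕ
open import Data.Integer using (+_)
open import Data.Rational using (ℚ; 0ℚ; 1ℚ; _+_; _*_; _-_; _/_; ∣_∣; _<_; _≤_; _>_)

-- 1 / m  (for m ≥ 1; the value at 0 is never used)
inv : ℕ → ℚ
inv zero    = 0ℚ
inv (suc m) = + 1 / suc m

invPow : (j m : ℕ) → ℚ
invPow zero    m = 1ℚ
invPow (suc j) m = inv m * invPow j m

Σ₁ : ℕ → (ℕ → ℚ) → ℚ
Σ₁ zero    f = 0ℚ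
Σ₁ (suc N) f = Σ₁ N f + f (suc N)

H : ℕ → ℕ → ℚ
H j N = Σ₁ N (invPow j)

H1 : ℕ → ℚ
H1 = H 1

ℕ→ℚ : ℕ → ℚ
ℕ→ℚ n = + n / 1

ζpartial : ℕ → ℕ → ℚ
ζpartial s N = H s N

TendsToZero : (ℕ → ℚ) → Set
TendsToZero a = ∀ (ε : ℚ) → ε > 0ℚ →
  Σ ℕ λ N → ∀ M → N ℕ.≤ M → ∣ a M ∣ < ε
  where open import Data.Product using (Σ)

A1 A2 A3 : ℕ → ℚ
A1 n = H1 n
A2 n = H1 n * H1 n - H 2 n
A3 n = H1 n * H1 n * H1 n - ℕ→ℚ 3 * H1 n * H 2 n + ℕ→ℚ 2 * H 3 n

seriesPartial : (ℕ → ℚ) → ℕ → ℕ → ℚ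
seriesPartial a k M = Σ₁ M (λ n → a n * inv (n ℕ.* (n ℕ.+ k)))

module Submission where

-- These numerators are 1!e₁, 2!e₂, 3!e₃ for the elementary symmetric functions e_p(n)
-- of 1, 1/2, …, 1/n, and the right-hand sides are built from the complete symmetric
-- functions h_q(K) of 1, …, 1/K (Newton's identities).

open import Defs
open import Data.Nat using (ℕ; suc)
open import Data.Product using (_×_)
open import Data.Rational using (ℚ; _+_; _*_; _-_)

open import Data.Nat as ℕ using (zero; _∸_; _^_)
import Data.Nat.Properties as ℕP
open import Data.Integer as ℤ using (ℤ; +_; +[1+_])
import Data.Integer.Properties as ℤP
import Data.Integer.Tactic.RingSolver as ℤ-Solver
import Data.Nat.Tactic.RingSolver as ℕ-Solver
open import Data.Rational using (0ℚ; 1ℚ; ½; -_; ∣_∣; _≤_; _<_; _>_; mkℚ; *<*; fromℚᵘ; _≟_; nonNegative; positive)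
open import Data.Rational.Properties
import Data.Rational.Unnormalised as ℚᵘ
import Data.Rational.Unnormalised.Properties as ℚᵘP
open import Data.Product using (Σ; _,_; proj₁; proj₂)
open import Data.Sum using (inj₁; inj₂)
open import Data.Empty using (⊥-elim)
open import Data.List using (_∷_; [])
open import Data.Maybe using (Maybe; just; nothing)
open import Data.Unit using (tt)
open import Relation.Nullary using (yes; no)
open import Relation.Nullary.Decidable using (toWitness)
open import Relation.Binary.PropositionalEquality
open import Tactic.RingSolver using (solve-∀)
open import Tactic.RingSolver.Core.AlmostCommutativeRing using (AlmostCommutativeRing; fromCommutativeRing)

ℚ-ring : AlmostCommutativeRing _ _
ℚ-ring = fromCommutativeRing +-*-commutativeRing is-zero?
  where
  is-zero? : ∀ x → Maybe (0ℚ ≡ x)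
  is-zero? x with 0ℚ ≟ x
  ... | yes p = just p
  ... | no _  = nothing

-- An analogue of `linear_combination`: an equation c = d follows from
-- hypotheses aᵢ = bᵢ once the ring identity c - d = Σ kᵢ (aᵢ - bᵢ) is checked.
difference-zero : ∀ {c d} → c - d ≡ 0ℚ → c ≡ d
difference-zero {c} {d} eq = begin
    c              ≡⟨ shift c d ⟩
    (c - d) + d    ≡⟨ cong (_+ d) eq ⟩
    0ℚ + d         ≡⟨ +-identityˡ d ⟩
    d ∎
  where
  open ≡-Reasoning
  shift : ∀ c d → c ≡ (c - d) + d
  shift = solve-∀ ℚ-ring

combine₁ : ∀ {c d a₁ b₁} k₁ → c - d ≡ k₁ * (a₁ - b₁) → a₁ ≡ b₁ → c ≡ d
combine₁ {a₁ = a} k eq refl = difference-zero (trans eq (vanish k a))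
  where
  vanish : ∀ k a → k * (a - a) ≡ 0ℚ
  vanish = solve-∀ ℚ-ring

drop-vanishing : ∀ X k a → X + k * (a - a) ≡ X
drop-vanishing = solve-∀ ℚ-ring

combine₂ : ∀ {c d a₁ b₁ a₂ b₂} k₁ k₂ →
           c - d ≡ k₁ * (a₁ - b₁) + k₂ * (a₂ - b₂) → a₁ ≡ b₁ → a₂ ≡ b₂ → c ≡ d
combine₂ {a₂ = a} k₁ k₂ eq h₁ refl = combine₁ k₁ (trans eq (drop-vanishing _ k₂ a)) h₁

combine₃ : ∀ {c d a₁ b₁ a₂ b₂ a₃ b₃} k₁ k₂ k₃ →
           c - d ≡ k₁ * (a₁ - b₁) + k₂ * (a₂ - b₂) + k₃ * (a₃ - b₃) →
           a₁ ≡ b₁ → a₂ ≡ b₂ → a₃ ≡ b₃ → c ≡ d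
combine₃ {a₃ = a} k₁ k₂ k₃ eq h₁ h₂ refl = combine₂ k₁ k₂ (trans eq (drop-vanishing _ k₃ a)) h₁ h₂

combine₄ : ∀ {c d a₁ b₁ a₂ b₂ a₃ b₃ a₄ b₄} k₁ k₂ k₃ k₄ →
           c - d ≡ k₁ * (a₁ - b₁) + k₂ * (a₂ - b₂) + k₃ * (a₃ - b₃) + k₄ * (a₄ - b₄) →
           a₁ ≡ b₁ → a₂ ≡ b₂ → a₃ ≡ b₃ → a₄ ≡ b₄ → c ≡ d
combine₄ {a₄ = a} k₁ k₂ k₃ k₄ eq h₁ h₂ h₃ refl = combine₃ k₁ k₂ k₃ (trans eq (drop-vanishing _ k₄ a)) h₁ h₂ h₃

combine₅ : ∀ {c d a₁ b₁ a₂ b₂ a₃ b₃ a₄ b₄ a₅ b₅} k₁ k₂ k₃ k₄ k₅ →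
           c - d ≡ k₁ * (a₁ - b₁) + k₂ * (a₂ - b₂) + k₃ * (a₃ - b₃) + k₄ * (a₄ - b₄) + k₅ * (a₅ - b₅) →
           a₁ ≡ b₁ → a₂ ≡ b₂ → a₃ ≡ b₃ → a₄ ≡ b₄ → a₅ ≡ b₅ → c ≡ d
combine₅ {a₅ = a} k₁ k₂ k₃ k₄ k₅ eq h₁ h₂ h₃ h₄ refl =
  combine₄ k₁ k₂ k₃ k₄ (trans eq (drop-vanishing _ k₅ a)) h₁ h₂ h₃ h₄

-- `fromℚᵘ` commutes with the ring operations; it lets us compute with the
-- unnormalised representations of ℕ→ℚ n = n/1 and inv (suc n) = 1/(suc n).
fromℚᵘ-+ : ∀ a b → fromℚᵘ a + fromℚᵘ b ≡ fromℚᵘ (a ℚᵘ.+ b)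
fromℚᵘ-+ a b = toℚᵘ-injective (ℚᵘP.≃-trans (toℚᵘ-homo-+ (fromℚᵘ a) (fromℚᵘ b))
  (ℚᵘP.≃-trans (ℚᵘP.+-cong (toℚᵘ-fromℚᵘ a) (toℚᵘ-fromℚᵘ b)) (ℚᵘP.≃-sym (toℚᵘ-fromℚᵘ (a ℚᵘ.+ b)))))

fromℚᵘ-* : ∀ a b → fromℚᵘ a * fromℚᵘ b ≡ fromℚᵘ (a ℚᵘ.* b)
fromℚᵘ-* a b = toℚᵘ-injective (ℚᵘP.≃-trans (toℚᵘ-homo-* (fromℚᵘ a) (fromℚᵘ b))
  (ℚᵘP.≃-trans (ℚᵘP.*-cong (toℚᵘ-fromℚᵘ a) (toℚᵘ-fromℚᵘ b)) (ℚᵘP.≃-sym (toℚᵘ-fromℚᵘ (a ℚᵘ.* b)))))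

fromℚᵘ-mono-≤ : ∀ {a b} → a ℚᵘ.≤ b → fromℚᵘ a ≤ fromℚᵘ b
fromℚᵘ-mono-≤ {a} {b} a≤b = toℚᵘ-cancel-≤ (ℚᵘP.≤-respʳ-≃ (ℚᵘP.≃-sym (toℚᵘ-fromℚᵘ b))
   (ℚᵘP.≤-respˡ-≃ (ℚᵘP.≃-sym (toℚᵘ-fromℚᵘ a)) a≤b))

fromℚᵘ-mono-< : ∀ {a b} → a ℚᵘ.< b → fromℚᵘ a < fromℚᵘ b
fromℚᵘ-mono-< {a} {b} a<b = toℚᵘ-cancel-< (ℚᵘP.<-respʳ-≃ (ℚᵘP.≃-sym (toℚᵘ-fromℚᵘ b))
   (ℚᵘP.<-respˡ-≃ (ℚᵘP.≃-sym (toℚᵘ-fromℚᵘ a)) a<b))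

ℕ→ℚ-suc : ∀ n → ℕ→ℚ (suc n) ≡ ℕ→ℚ n + 1ℚ
ℕ→ℚ-suc n = sym (trans (fromℚᵘ-+ (ℚᵘ.mkℚᵘ (+ n) 0) (ℚᵘ.mkℚᵘ (+ 1) 0))
  (fromℚᵘ-cong {ℚᵘ.mkℚᵘ (+ n) 0 ℚᵘ.+ ℚᵘ.mkℚᵘ (+ 1) 0} {ℚᵘ.mkℚᵘ (+ suc n) 0}
    (ℚᵘ.*≡* (cross (+ n) (+ suc n) (cong +_ (ℕP.+-comm 1 n))))))
  where
  cross : ∀ x y → y ≡ x ℤ.+ + 1 → (x ℤ.* + 1 ℤ.+ + 1 ℤ.* + 1) ℤ.* + 1 ≡ y ℤ.* (+ 1 ℤ.* + 1)
  cross x _ refl = ℤ-Solver.solve (x ∷ [])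

ℕ→ℚ-+ : ∀ m n → ℕ→ℚ (m ℕ.+ n) ≡ ℕ→ℚ m + ℕ→ℚ n
ℕ→ℚ-+ zero    n = sym (+-identityˡ (ℕ→ℚ n))
ℕ→ℚ-+ (suc m) n = begin
    ℕ→ℚ (suc (m ℕ.+ n))       ≡⟨ ℕ→ℚ-suc (m ℕ.+ n) ⟩
    ℕ→ℚ (m ℕ.+ n) + 1ℚ        ≡⟨ cong (_+ 1ℚ) (ℕ→ℚ-+ m n) ⟩
    (ℕ→ℚ m + ℕ→ℚ n) + 1ℚ      ≡⟨ swap (ℕ→ℚ m) (ℕ→ℚ n) ⟩
    (ℕ→ℚ m + 1ℚ) + ℕ→ℚ n      ≡⟨ cong (_+ ℕ→ℚ n) (sym (ℕ→ℚ-suc m)) ⟩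
    ℕ→ℚ (suc m) + ℕ→ℚ n ∎
  where
  open ≡-Reasoning
  swap : ∀ a b → (a + b) + 1ℚ ≡ (a + 1ℚ) + b
  swap = solve-∀ ℚ-ring

ℕ→ℚ-* : ∀ m n → ℕ→ℚ (m ℕ.* n) ≡ ℕ→ℚ m * ℕ→ℚ n
ℕ→ℚ-* zero    n = sym (*-zeroˡ (ℕ→ℚ n))
ℕ→ℚ-* (suc m) n = begin
    ℕ→ℚ (n ℕ.+ m ℕ.* n)       ≡⟨ ℕ→ℚ-+ n (m ℕ.* n) ⟩
    ℕ→ℚ n + ℕ→ℚ (m ℕ.* n)     ≡⟨ cong (λ z → ℕ→ℚ n + z) (ℕ→ℚ-* m n) ⟩
    ℕ→ℚ n + ℕ→ℚ m * ℕ→ℚ n     ≡⟨ factor (ℕ→ℚ m) (ℕ→ℚ n) ⟩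
    (ℕ→ℚ m + 1ℚ) * ℕ→ℚ n      ≡⟨ cong (_* ℕ→ℚ n) (sym (ℕ→ℚ-suc m)) ⟩
    ℕ→ℚ (suc m) * ℕ→ℚ n ∎
  where
  open ≡-Reasoning
  factor : ∀ a b → b + a * b ≡ (a + 1ℚ) * b
  factor = solve-∀ ℚ-ring

ℕ→ℚ*inv : ∀ n → ℕ→ℚ (suc n) * inv (suc n) ≡ 1ℚ
ℕ→ℚ*inv n = trans (fromℚᵘ-* (ℚᵘ.mkℚᵘ (+ suc n) 0) (ℚᵘ.mkℚᵘ (+ 1) n))
  (fromℚᵘ-cong {ℚᵘ.mkℚᵘ (+ suc n) 0 ℚᵘ.* ℚᵘ.mkℚᵘ (+ 1) n} {ℚᵘ.mkℚᵘ (+ 1) 0} (ℚᵘ.*≡* (cross (+ suc n))))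
  where
  cross : ∀ x → (x ℤ.* + 1) ℤ.* + 1 ≡ + 1 ℤ.* (+ 1 ℤ.* x)
  cross x = ℤ-Solver.solve (x ∷ [])

inverse-unique : ∀ x a b → x * a ≡ 1ℚ → x * b ≡ 1ℚ → a ≡ b
inverse-unique x a b xa≡1 xb≡1 = begin
    a                 ≡⟨ sym (*-identityʳ a) ⟩
    a * 1ℚ            ≡⟨ cong (a *_) (sym xb≡1) ⟩
    a * (x * b)       ≡⟨ regroup a x b ⟩
    (x * a) * b       ≡⟨ cong (_* b) xa≡1 ⟩
    1ℚ * b            ≡⟨ *-identityˡ b ⟩
    b ∎
  where
  open ≡-Reasoning
  regroup : ∀ a x b → a * (x * b) ≡ (x * a) * b
  regroup = solve-∀ ℚ-ring

inv-* : ∀ m n → inv (m ℕ.* n) ≡ inv m * inv n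
inv-* zero    n = sym (*-zeroˡ (inv n))
inv-* (suc m) zero rewrite ℕP.*-zeroʳ m = sym (*-zeroʳ (inv (suc m)))
inv-* (suc m) (suc n) =
  inverse-unique (ℕ→ℚ (suc m ℕ.* suc n)) _ _ (ℕ→ℚ*inv (n ℕ.+ m ℕ.* suc n)) product-inverse
  where
  open ≡-Reasoning
  A = ℕ→ℚ (suc m)
  B = ℕ→ℚ (suc n)
  x = inv (suc m)
  y = inv (suc n)
  regroup : ∀ a b x y → (a * b) * (x * y) ≡ (a * x) * (b * y)
  regroup = solve-∀ ℚ-ring
  product-inverse : ℕ→ℚ (suc m ℕ.* suc n) * (x * y) ≡ 1ℚ
  product-inverse = begin
    ℕ→ℚ (suc m ℕ.* suc n) * (x * y)  ≡⟨ cong (_* (x * y)) (ℕ→ℚ-* (suc m) (suc n)) ⟩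
    (A * B) * (x * y)                 ≡⟨ regroup A B x y ⟩
    (A * x) * (B * y)                 ≡⟨ cong₂ _*_ (ℕ→ℚ*inv m) (ℕ→ℚ*inv n) ⟩
    1ℚ * 1ℚ ∎

partial-fractions : ∀ a b → inv (suc a) * inv (suc b) ≡ inv (suc a ℕ.+ suc b) * (inv (suc a) + inv (suc b))
partial-fractions a b = field-identity (ℕ→ℚ (suc a)) (ℕ→ℚ (suc b)) _ _ _ (ℕ→ℚ*inv a) (ℕ→ℚ*inv b)
   (trans (cong (_* inv (suc a ℕ.+ suc b)) (sym (ℕ→ℚ-+ (suc a) (suc b)))) (ℕ→ℚ*inv (a ℕ.+ suc b)))
  where
  open ≡-Reasoning
  field-identity : ∀ α β A B X → α * A ≡ 1ℚ → β * B ≡ 1ℚ → (α + β) * X ≡ 1ℚ → A * B ≡ X * (A + B)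
  field-identity α β A B X αA≡1 βB≡1 γX≡1 = begin
      A * B                               ≡⟨ sym (*-identityʳ (A * B)) ⟩
      A * B * 1ℚ                          ≡⟨ cong (A * B *_) (sym γX≡1) ⟩
      A * B * ((α + β) * X)               ≡⟨ expand α β A B X ⟩
      (α * A) * B * X + (β * B) * A * X   ≡⟨ cong₂ (λ u v → u * B * X + v * A * X) αA≡1 βB≡1 ⟩
      1ℚ * B * X + 1ℚ * A * X             ≡⟨ collect A B X ⟩
      X * (A + B) ∎
    where
    expand : ∀ α β A B X → A * B * ((α + β) * X) ≡ (α * A) * B * X + (β * B) * A * X
    expand = solve-∀ ℚ-ring
    collect : ∀ A B X → 1ℚ * B * X + 1ℚ * A * X ≡ X * (A + B)
    collect = solve-∀ ℚ-ring

-- If a x = c (a + x) then a c = x (a - c).  With a = 1/n, c = 1/(n+K), x = 1/K (where the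
-- hypothesis is `partial-fractions`) this reads 1/(n(n+K)) = (1/K)(1/n - 1/(n+K)).
product-as-difference : ∀ a c x → a * x ≡ c * (a + x) → a * c ≡ x * (a - c)
product-as-difference a c x h = combine₁ (- 1ℚ) (rearrange a c x) h
  where
  rearrange : ∀ a c x → a * c - x * (a - c) ≡ - 1ℚ * (a * x - c * (a + x))
  rearrange = solve-∀ ℚ-ring

0≤1 : 0ℚ ≤ 1ℚ
0≤1 = nonNegative⁻¹ 1ℚ

nonneg-+ : ∀ {a b} → 0ℚ ≤ a → 0ℚ ≤ b → 0ℚ ≤ a + b
nonneg-+ p q = ≤-trans (≤-reflexive (sym (+-identityʳ 0ℚ))) (+-mono-≤ p q)

nonneg-* : ∀ {a b} → 0ℚ ≤ a → 0ℚ ≤ b → 0ℚ ≤ a * b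
nonneg-* {a} p q = ≤-trans (≤-reflexive (sym (*-zeroʳ a))) (*-monoˡ-≤-nonNeg a {{nonNegative p}} q)

*-mono-≤-nonneg : ∀ {a b c d} → 0ℚ ≤ a → 0ℚ ≤ c → a ≤ b → c ≤ d → a * c ≤ b * d
*-mono-≤-nonneg {a} {b} {c} 0≤a 0≤c a≤b c≤d =
  ≤-trans (*-monoʳ-≤-nonNeg c {{nonNegative 0≤c}} a≤b)
          (*-monoˡ-≤-nonNeg b {{nonNegative (≤-trans 0≤a a≤b)}} c≤d)

difference-nonneg : ∀ {a b} → a ≤ b → 0ℚ ≤ b - a
difference-nonneg {a} a≤b = ≤-trans (≤-reflexive (sym (+-inverseʳ a))) (+-monoˡ-≤ (- a) a≤b)

difference-≤ : ∀ {a b c} → a ≤ b + c → a - b ≤ c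
difference-≤ {a} {b} {c} h = ≤-trans (+-monoˡ-≤ (- b) h) (≤-reflexive (cancel b c))
  where
  cancel : ∀ b c → b + c - b ≡ c
  cancel = solve-∀ ℚ-ring

≤-square : ∀ {h} → 1ℚ ≤ h → h ≤ h * h
≤-square {h} 1≤h = ≤-trans (≤-reflexive (sym (*-identityˡ h))) (*-monoʳ-≤-nonNeg h {{nonNegative (≤-trans 0≤1 1≤h)}} 1≤h)

p≤∣p∣ : ∀ p → p ≤ ∣ p ∣
p≤∣p∣ p with ≤-total p 0ℚ
... | inj₁ p≤0 = ≤-trans p≤0 (0≤∣p∣ p)
... | inj₂ 0≤p = ≤-reflexive (sym (0≤p⇒∣p∣≡p 0≤p))

ℕ→ℚ-mono : ∀ {m n} → m ℕ.≤ n → ℕ→ℚ m ≤ ℕ→ℚ n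
ℕ→ℚ-mono {m} {n} m≤n = fromℚᵘ-mono-≤ {ℚᵘ.mkℚᵘ (+ m) 0} {ℚᵘ.mkℚᵘ (+ n) 0}
  (ℚᵘ.*≤* (ℤP.*-monoʳ-≤-nonNeg (+ 1) (ℤ.+≤+ m≤n)))

ℕ→ℚ-nonneg : ∀ n → 0ℚ ≤ ℕ→ℚ n
ℕ→ℚ-nonneg n = ℕ→ℚ-mono {0} {n} ℕ.z≤n

inv-antitone : ∀ {m n} → m ℕ.≤ n → inv (suc n) ≤ inv (suc m)
inv-antitone {m} {n} m≤n = fromℚᵘ-mono-≤ {ℚᵘ.mkℚᵘ (+ 1) n} {ℚᵘ.mkℚᵘ (+ 1) m}
  (ℚᵘ.*≤* (ℤP.*-monoˡ-≤-nonNeg (+ 1) (ℤ.+≤+ (ℕ.s≤s m≤n))))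

inv-nonneg : ∀ n → 0ℚ ≤ inv n
inv-nonneg zero    = ≤-refl
inv-nonneg (suc n) = fromℚᵘ-mono-≤ {ℚᵘ.mkℚᵘ (+ 0) 0} {ℚᵘ.mkℚᵘ (+ 1) n} (ℚᵘ.*≤* (ℤ.+≤+ ℕ.z≤n))

inv≤1 : ∀ n → inv n ≤ 1ℚ
inv≤1 zero    = 0≤1
inv≤1 (suc n) = inv-antitone {0} {n} ℕ.z≤n

∣inv∣≤1 : ∀ n → ∣ inv n ∣ ≤ 1ℚ
∣inv∣≤1 n = ≤-trans (≤-reflexive (0≤p⇒∣p∣≡p (inv-nonneg n))) (inv≤1 n)

archimedean : ∀ ε → ε > 0ℚ → Σ ℕ λ n → inv (suc n) < ε
archimedean (mkℚ +[1+ p ] q c) (*<* _) = suc q ,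
  subst (inv (suc (suc q)) <_) (fromℚᵘ-toℚᵘ (mkℚ +[1+ p ] q c))
    (fromℚᵘ-mono-< {ℚᵘ.mkℚᵘ (+ 1) (suc q)} {ℚᵘ.mkℚᵘ +[1+ p ] q}
      (ℚᵘ.*<* (subst (ℤ._< +[1+ p ] ℤ.* + suc (suc q)) (sym (ℤP.*-identityˡ (+ suc q)))
        (ℤ.+<+ (ℕP.<-≤-trans (ℕP.n<1+n (suc q)) (ℕP.m≤n*m (suc (suc q)) (suc p)))))))
archimedean (mkℚ (+ 0)      q c) (*<* (ℤ.+<+ ()))
archimedean (mkℚ ℤ.-[1+ p ] q c) (*<* ())

Σ-+ : ∀ N (f g : ℕ → ℚ) → Σ₁ N (λ i → f i + g i) ≡ Σ₁ N f + Σ₁ N g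
Σ-+ zero    f g = refl
Σ-+ (suc N) f g = trans (cong (_+ (f (suc N) + g (suc N))) (Σ-+ N f g))
  (interchange (Σ₁ N f) (Σ₁ N g) (f (suc N)) (g (suc N)))
  where
  interchange : ∀ a b c d → (a + b) + (c + d) ≡ (a + c) + (b + d)
  interchange = solve-∀ ℚ-ring

Σ-- : ∀ N (f g : ℕ → ℚ) → Σ₁ N (λ i → f i - g i) ≡ Σ₁ N f - Σ₁ N g
Σ-- zero    f g = refl
Σ-- (suc N) f g = trans (cong (_+ (f (suc N) - g (suc N))) (Σ-- N f g))
  (interchange (Σ₁ N f) (Σ₁ N g) (f (suc N)) (g (suc N)))
  where
  interchange : ∀ a b c d → (a - b) + (c - d) ≡ (a + c) - (b + d)
  interchange = solve-∀ ℚ-ring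

Σ-*ˡ : ∀ N c (f : ℕ → ℚ) → Σ₁ N (λ i → c * f i) ≡ c * Σ₁ N f
Σ-*ˡ zero    c f = sym (*-zeroʳ c)
Σ-*ˡ (suc N) c f = trans (cong (_+ (c * f (suc N))) (Σ-*ˡ N c f))
  (sym (*-distribˡ-+ c (Σ₁ N f) (f (suc N))))

Σ-cong : ∀ N {f g : ℕ → ℚ} → (∀ i → i ℕ.< N → f (suc i) ≡ g (suc i)) → Σ₁ N f ≡ Σ₁ N g
Σ-cong zero    eq = refl
Σ-cong (suc N) eq = cong₂ _+_ (Σ-cong N (λ i i<N → eq i (ℕP.m<n⇒m<1+n i<N))) (eq N (ℕP.n<1+n N))

Σ-mono : ∀ N {f g : ℕ → ℚ} → (∀ i → i ℕ.< N → f (suc i) ≤ g (suc i)) → Σ₁ N f ≤ Σ₁ N g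
Σ-mono zero    le = ≤-refl
Σ-mono (suc N) le = +-mono-≤ (Σ-mono N (λ i i<N → le i (ℕP.m<n⇒m<1+n i<N))) (le N (ℕP.n<1+n N))

Σ-zero : ∀ N → Σ₁ N (λ _ → 0ℚ) ≡ 0ℚ
Σ-zero zero    = refl
Σ-zero (suc N) = trans (+-identityʳ _) (Σ-zero N)

Σ-nonneg : ∀ N {f : ℕ → ℚ} → (∀ i → i ℕ.< N → 0ℚ ≤ f (suc i)) → 0ℚ ≤ Σ₁ N f
Σ-nonneg N h = ≤-trans (≤-reflexive (sym (Σ-zero N))) (Σ-mono N h)

Σ-head : ∀ N (f : ℕ → ℚ) → Σ₁ (suc N) f ≡ f 1 + Σ₁ N (λ i → f (suc i))
Σ-head zero    f = trans (+-identityˡ (f 1)) (sym (+-identityʳ (f 1)))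
Σ-head (suc N) f = trans (cong (_+ f (suc (suc N))) (Σ-head N f)) (+-assoc (f 1) _ _)

Σ-reflect : ∀ N (f : ℕ → ℚ) → Σ₁ N f ≡ Σ₁ N (λ i → f (suc N ∸ i))
Σ-reflect zero    f = refl
Σ-reflect (suc N) f = trans (cong (_+ f (suc N)) (Σ-reflect N f))
  (trans (+-comm _ (f (suc N))) (sym (Σ-head N (λ i → f (suc (suc N) ∸ i)))))

null-dominated : ∀ {a b : ℕ → ℚ} N₀ → (∀ M → N₀ ℕ.≤ M → ∣ a M ∣ ≤ ∣ b M ∣) → TendsToZero b → TendsToZero a
null-dominated N₀ a≤b b→0 ε ε>0 with b→0 ε ε>0
... | N , small = N₀ ℕ.⊔ N , λ M N₀⊔N≤M →
  ≤-<-trans (a≤b M (ℕP.≤-trans (ℕP.m≤m⊔n N₀ N) N₀⊔N≤M)) (small M (ℕP.≤-trans (ℕP.m≤n⊔m N₀ N) N₀⊔N≤M))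

null-bounded : ∀ {a b : ℕ → ℚ} N₀ → (∀ M → N₀ ℕ.≤ M → ∣ a M ∣ ≤ b M) → TendsToZero b → TendsToZero a
null-bounded N₀ a≤b = null-dominated N₀ (λ M N₀≤M → ≤-trans (a≤b M N₀≤M) (p≤∣p∣ _))

null-cong : ∀ {a b : ℕ → ℚ} → (∀ M → a M ≡ b M) → TendsToZero a → TendsToZero b
null-cong a≡b = null-dominated 0 (λ M _ → ≤-reflexive (cong ∣_∣ (sym (a≡b M))))

null-zero : TendsToZero (λ _ → 0ℚ)
null-zero ε ε>0 = 0 , λ _ _ → ε>0

half-positive : ∀ {ε} → ε > 0ℚ → ε * ½ > 0ℚ
half-positive {ε} ε>0 = positive⁻¹ (ε * ½) {{pos*pos⇒pos ε {{positive ε>0}} ½}}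

null-+ : ∀ {a b : ℕ → ℚ} → TendsToZero a → TendsToZero b → TendsToZero (λ M → a M + b M)
null-+ {a} {b} a→0 b→0 ε ε>0 with a→0 (ε * ½) (half-positive ε>0) | b→0 (ε * ½) (half-positive ε>0)
... | N₁ , small₁ | N₂ , small₂ = N₁ ℕ.⊔ N₂ , λ M N≤M →
  ≤-<-trans (∣p+q∣≤∣p∣+∣q∣ (a M) (b M))
    (<-respʳ-≡ (halves ε) (+-mono-< (small₁ M (ℕP.≤-trans (ℕP.m≤m⊔n N₁ N₂) N≤M))
                                     (small₂ M (ℕP.≤-trans (ℕP.m≤n⊔m N₁ N₂) N≤M))))
  where
  halves : ∀ ε → ε * ½ + ε * ½ ≡ ε
  halves = solve-∀ ℚ-ring

null-- : ∀ {a b : ℕ → ℚ} → TendsToZero a → TendsToZero b → TendsToZero (λ M → a M - b M)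
null-- {b = b} a→0 b→0 = null-+ a→0 (null-dominated 0 (λ M _ → ≤-reflexive (∣-p∣≡∣p∣ (b M))) b→0)

null-scale : ∀ {a : ℕ → ℚ} c → ∣ c ∣ ≤ 1ℚ → TendsToZero a → TendsToZero (λ M → c * a M)
null-scale {a} c ∣c∣≤1 = null-dominated 0 (λ M _ → begin
    ∣ c * a M ∣        ≡⟨ ∣p*q∣≡∣p∣*∣q∣ c (a M) ⟩
    ∣ c ∣ * ∣ a M ∣    ≤⟨ *-monoʳ-≤-nonNeg ∣ a M ∣ {{∣-∣-nonNeg (a M)}} ∣c∣≤1 ⟩
    1ℚ * ∣ a M ∣       ≡⟨ *-identityˡ _ ⟩
    ∣ a M ∣ ∎)
  where open ≤-Reasoning

null-scaleℕ : ∀ {a : ℕ → ℚ} n → TendsToZero a → TendsToZero (λ M → ℕ→ℚ n * a M)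
null-scaleℕ {a} zero    a→0 = null-cong (λ M → sym (*-zeroˡ (a M))) null-zero
null-scaleℕ {a} (suc n) a→0 = null-cong (λ M → trans (factor (ℕ→ℚ n) (a M)) (cong (_* a M) (sym (ℕ→ℚ-suc n))))
  (null-+ (null-scaleℕ n a→0) a→0)
  where
  factor : ∀ x y → x * y + y ≡ (x + 1ℚ) * y
  factor = solve-∀ ℚ-ring

null-shift : ∀ {a : ℕ → ℚ} → TendsToZero a → TendsToZero (λ M → a (M ∸ 1))
null-shift a→0 ε ε>0 with a→0 ε ε>0
... | N , small = suc N , λ M 1+N≤M → small (M ∸ 1) (ℕP.∸-monoˡ-≤ 1 1+N≤M)

-- Growth of the harmonic numbers.  H is nonnegative and increasing, a block of r
-- terms after position a contributes at most r/(a+1), hence H_{2^m - 1} ≤ m.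
H1-nonneg : ∀ M → 0ℚ ≤ H1 M
H1-nonneg M = Σ-nonneg M (λ i _ → nonneg-* (inv-nonneg (suc i)) 0≤1)

H1-≤-suc : ∀ n → H1 n ≤ H1 (suc n)
H1-≤-suc n = ≤-trans (≤-reflexive (sym (+-identityʳ (H1 n))))
  (+-monoʳ-≤ (H1 n) (nonneg-* (inv-nonneg (suc n)) 0≤1))

H1-mono : ∀ {m n} → m ℕ.≤ n → H1 m ≤ H1 n
H1-mono m≤n = monotone (ℕP.≤⇒≤′ m≤n)
  where
  monotone : ∀ {m n} → m ℕ.≤′ n → H1 m ≤ H1 n
  monotone ℕ.≤′-refl                    = ≤-refl
  monotone {n = suc n} (ℕ.≤′-step m≤′n) = ≤-trans (monotone m≤′n) (H1-≤-suc n)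

H1≥1 : ∀ m → 1ℚ ≤ H1 (suc m)
H1≥1 m = H1-mono {1} {suc m} (ℕ.s≤s ℕ.z≤n)

harmonic-block : ∀ a r → H1 (a ℕ.+ r) ≤ H1 a + ℕ→ℚ r * inv (suc a)
harmonic-block a zero rewrite ℕP.+-identityʳ a =
  ≤-reflexive (sym (trans (cong (λ z → H1 a + z) (*-zeroˡ (inv (suc a)))) (+-identityʳ (H1 a))))
harmonic-block a (suc r) rewrite ℕP.+-suc a r = begin
    H1 (a ℕ.+ r) + inv (suc (a ℕ.+ r)) * 1ℚ   ≤⟨ +-mono-≤ (harmonic-block a r) last-term ⟩
    (H1 a + ℕ→ℚ r * inv (suc a)) + inv (suc a)  ≡⟨ collect (H1 a) (ℕ→ℚ r) (inv (suc a)) ⟩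
    H1 a + (ℕ→ℚ r + 1ℚ) * inv (suc a)           ≡⟨ cong (λ z → H1 a + z * inv (suc a)) (sym (ℕ→ℚ-suc r)) ⟩
    H1 a + ℕ→ℚ (suc r) * inv (suc a) ∎
  where
  open ≤-Reasoning
  last-term : inv (suc (a ℕ.+ r)) * 1ℚ ≤ inv (suc a)
  last-term = ≤-trans (≤-reflexive (*-identityʳ _)) (inv-antitone (ℕP.m≤m+n a r))
  collect : ∀ h x y → (h + x * y) + y ≡ h + (x + 1ℚ) * y
  collect = solve-∀ ℚ-ring

2^-positive : ∀ m → Σ ℕ (λ k → 2 ^ m ≡ suc k)
2^-positive zero = 0 , refl
2^-positive (suc m) with 2^-positive m
... | k , 2^m≡1+k = k ℕ.+ suc (k ℕ.+ 0) , cong (2 ℕ.*_) 2^m≡1+k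

harmonic-dyadic : ∀ m → H1 (2 ^ m ∸ 1) ≤ ℕ→ℚ m
harmonic-dyadic zero    = ≤-refl
harmonic-dyadic (suc m) = doubling (2^-positive m) (harmonic-dyadic m)
  where
  -- the block (2^m, 2^{m+1}) has 2^m terms, each at most 1/2^m
  doubling : Σ ℕ (λ k → 2 ^ m ≡ suc k) → H1 (2 ^ m ∸ 1) ≤ ℕ→ℚ m → H1 (2 ^ suc m ∸ 1) ≤ ℕ→ℚ (suc m)
  doubling (k , 2^m≡1+k) ih rewrite 2^m≡1+k | ℕP.+-identityʳ k = ≤-trans (harmonic-block k (suc k))
     (≤-trans (+-mono-≤ ih (≤-reflexive (ℕ→ℚ*inv k))) (≤-reflexive (sym (ℕ→ℚ-suc m))))

harmonic-log : ∀ m M → M ℕ.< 2 ^ m → H1 M ≤ ℕ→ℚ m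
harmonic-log m M M<2^m with 2^-positive m
... | k , 2^m≡1+k = ≤-trans (H1-mono (ℕP.≤-pred (subst (M ℕ.<_) 2^m≡1+k M<2^m)))
                            (subst (λ z → H1 (z ∸ 1) ≤ ℕ→ℚ m) 2^m≡1+k (harmonic-dyadic m))

dyadic-bracket : ∀ M → Σ ℕ λ m → (2 ^ m ℕ.≤ suc M) × (suc M ℕ.< 2 ^ suc m)
dyadic-bracket zero = 0 , ℕP.≤-refl , ℕ.s≤s (ℕ.s≤s ℕ.z≤n)
dyadic-bracket (suc M) with dyadic-bracket M
... | m , lo , hi with ℕP.m≤n⇒m<n∨m≡n hi
... | inj₁ 2+M<2^m+1 = m , ℕP.m≤n⇒m≤1+n lo , 2+M<2^m+1
... | inj₂ 2+M≡2^m+1 = suc m , ℕP.≤-reflexive (sym 2+M≡2^m+1) ,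
  subst (ℕ._< 2 ^ suc (suc m)) (sym 2+M≡2^m+1) (ℕP.^-monoʳ-< 2 (ℕ.s≤s (ℕ.s≤s ℕ.z≤n)) (ℕP.n<1+n (suc m)))

-- (m+1)^4 ≤ 41·2^m: checked directly for m ≤ 6, and for m = t+7 by induction on t,
-- using (t+9)^4 ≤ 2 (t+8)^4.
quartic≤exponential : ∀ m → (suc m) ^ 4 ℕ.≤ 41 ℕ.* 2 ^ m
quartic≤exponential 0 = toWitness {a? = 1 ℕ.≤? 41} tt
quartic≤exponential 1 = toWitness {a? = 16 ℕ.≤? 82} tt
quartic≤exponential 2 = toWitness {a? = 81 ℕ.≤? 164} tt
quartic≤exponential 3 = toWitness {a? = 256 ℕ.≤? 328} tt
quartic≤exponential 4 = toWitness {a? = 625 ℕ.≤? 656} tt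
quartic≤exponential 5 = toWitness {a? = 1296 ℕ.≤? 1312} tt
quartic≤exponential 6 = toWitness {a? = 2401 ℕ.≤? 2624} tt
quartic≤exponential (suc (suc (suc (suc (suc (suc (suc t))))))) =
  subst₂ (λ a b → a ^ 4 ℕ.≤ 41 ℕ.* 2 ^ b) (ℕP.+-comm t 8) (ℕP.+-comm t 7) (from-seven t)
  where
  from-seven : ∀ t → (t ℕ.+ 8) ^ 4 ℕ.≤ 41 ℕ.* 2 ^ (t ℕ.+ 7)
  from-seven zero    = toWitness {a? = 4096 ℕ.≤? 5248} tt
  from-seven (suc t) = ℕP.≤-trans ratio (ℕP.≤-trans (ℕP.*-monoʳ-≤ 2 (from-seven t)) (ℕP.≤-reflexive (commute (2 ^ (t ℕ.+ 7)))))
    where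
    commute : ∀ X → 2 ℕ.* (41 ℕ.* X) ≡ 41 ℕ.* (2 ℕ.* X)
    commute = ℕ-Solver.solve-∀
    -- (t+9)^4 + (positive polynomial) = 2 (t+8)^4, written with n^4 = n·(n·(n·(n·1)))
    expansion : ∀ t → (suc t ℕ.+ 8) ℕ.* ((suc t ℕ.+ 8) ℕ.* ((suc t ℕ.+ 8) ℕ.* ((suc t ℕ.+ 8) ℕ.* 1)))
                  ℕ.+ (t ℕ.* t ℕ.* t ℕ.* t ℕ.+ 28 ℕ.* (t ℕ.* t ℕ.* t) ℕ.+ 282 ℕ.* (t ℕ.* t) ℕ.+ 1180 ℕ.* t ℕ.+ 1631)
                ≡ 2 ℕ.* ((t ℕ.+ 8) ℕ.* ((t ℕ.+ 8) ℕ.* ((t ℕ.+ 8) ℕ.* ((t ℕ.+ 8) ℕ.* 1))))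
    expansion = ℕ-Solver.solve-∀
    ratio : (suc t ℕ.+ 8) ^ 4 ℕ.≤ 2 ℕ.* (t ℕ.+ 8) ^ 4
    ratio = subst ((suc t ℕ.+ 8) ^ 4 ℕ.≤_) (expansion t) (ℕP.m≤m+n _ _)

cube-over-dyadic : ∀ m → ℕ→ℚ (suc m) * ℕ→ℚ (suc m) * ℕ→ℚ (suc m) * inv (2 ^ m) ≤ ℕ→ℚ 41 * inv (suc m)
cube-over-dyadic m with 2^-positive m
... | k , 2^m≡1+k = begin
    x * x * x * z                           ≡⟨ sym (*-identityʳ _) ⟩
    x * x * x * z * 1ℚ                      ≡⟨ cong (x * x * x * z *_) (sym (ℕ→ℚ*inv m)) ⟩
    x * x * x * z * (x * y)                 ≡⟨ regroup x y z ⟩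
    (x * x * x * x) * z * y                 ≡⟨ cong (λ w → w * z * y) (sym (ℕ→ℚ-fourth (suc m))) ⟩
    ℕ→ℚ (suc m ^ 4) * z * y                  ≤⟨ *-monoʳ-≤-nonNeg y {{nonNegative (inv-nonneg (suc m))}}
                                                  (*-monoʳ-≤-nonNeg z {{nonNegative (inv-nonneg (2 ^ m))}}
                                                    (ℕ→ℚ-mono (quartic≤exponential m))) ⟩
    ℕ→ℚ (41 ℕ.* 2 ^ m) * z * y               ≡⟨ cong (λ w → w * z * y) (ℕ→ℚ-* 41 (2 ^ m)) ⟩
    ℕ→ℚ 41 * ℕ→ℚ (2 ^ m) * z * y             ≡⟨ regroup′ (ℕ→ℚ 41) (ℕ→ℚ (2 ^ m)) z y ⟩
    ℕ→ℚ 41 * (ℕ→ℚ (2 ^ m) * z) * y           ≡⟨ cong (λ w → ℕ→ℚ 41 * w * y) 2^m*inv≡1 ⟩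
    ℕ→ℚ 41 * 1ℚ * y                          ≡⟨ cong (_* y) (*-identityʳ (ℕ→ℚ 41)) ⟩
    ℕ→ℚ 41 * y ∎
  where
  open ≤-Reasoning
  x = ℕ→ℚ (suc m)
  y = inv (suc m)
  z = inv (2 ^ m)
  2^m*inv≡1 : ℕ→ℚ (2 ^ m) * inv (2 ^ m) ≡ 1ℚ
  2^m*inv≡1 rewrite 2^m≡1+k = ℕ→ℚ*inv k
  ℕ→ℚ-fourth : ∀ n → ℕ→ℚ (n ^ 4) ≡ ℕ→ℚ n * ℕ→ℚ n * ℕ→ℚ n * ℕ→ℚ n
  ℕ→ℚ-fourth n = trans (ℕ→ℚ-* n _) (trans (cong (ℕ→ℚ n *_) (trans (ℕ→ℚ-* n _)
    (cong (ℕ→ℚ n *_) (trans (ℕ→ℚ-* n _) (cong (ℕ→ℚ n *_) (ℕ→ℚ-* n 1)))))) (fourth (ℕ→ℚ n)))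
    where
    fourth : ∀ a → a * (a * (a * (a * ℕ→ℚ 1))) ≡ a * a * a * a
    fourth = solve-∀ ℚ-ring
  regroup : ∀ x y z → x * x * x * z * (x * y) ≡ (x * x * x * x) * z * y
  regroup = solve-∀ ℚ-ring
  regroup′ : ∀ a b z y → a * b * z * y ≡ a * (b * z) * y
  regroup′ = solve-∀ ℚ-ring

cube-nonneg : ∀ {a} → 0ℚ ≤ a → 0ℚ ≤ a * a * a
cube-nonneg 0≤a = nonneg-* (nonneg-* 0≤a 0≤a) 0≤a

cube-mono : ∀ {a b} → 0ℚ ≤ a → a ≤ b → a * a * a ≤ b * b * b
cube-mono 0≤a a≤b = *-mono-≤-nonneg (nonneg-* 0≤a 0≤a) 0≤a (*-mono-≤-nonneg 0≤a 0≤a a≤b a≤b) a≤b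

-- If 2^m ≤ M+1 < 2^{m+1} then H_M ≤ m+1 and 1/(M+1) ≤ 1/2^m, so
-- H_M³/(M+1) ≤ (m+1)³/2^m ≤ 41/(m+1).
harmonic-cube-bound : ∀ M → H1 M * H1 M * H1 M * inv (suc M) ≤ ℕ→ℚ 41 * inv (suc (proj₁ (dyadic-bracket M)))
harmonic-cube-bound M with dyadic-bracket M | 2^-positive (proj₁ (dyadic-bracket M))
... | m , lo , hi | k , 2^m≡1+k = ≤-trans
  (*-mono-≤-nonneg (cube-nonneg (H1-nonneg M)) (inv-nonneg (suc M))
    (cube-mono (H1-nonneg M) (harmonic-log (suc m) M (ℕP.<-trans (ℕP.n<1+n M) hi))) 1/[M+1]≤1/2^m)
  (cube-over-dyadic m)
  where
  1/[M+1]≤1/2^m : inv (suc M) ≤ inv (2 ^ m)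
  1/[M+1]≤1/2^m = subst (λ w → inv (suc M) ≤ inv w) (sym 2^m≡1+k)
    (inv-antitone (ℕP.≤-pred (subst (ℕ._≤ suc M) 2^m≡1+k lo)))

-- The basic null sequence dominating every error term of the proof.
harmonic-cube-null : TendsToZero (λ M → H1 M * H1 M * H1 M * inv (suc M))
harmonic-cube-null ε ε>0 with archimedean (ε * inv 41) (positive⁻¹ _ {{pos*pos⇒pos ε {{positive ε>0}} (inv 41)}})
... | n , 1/[n+1]<ε/41 = 2 ^ n , small
  where
  cancel41 : ∀ ε → ℕ→ℚ 41 * (ε * inv 41) ≡ ε
  cancel41 = solve-∀ ℚ-ring
  exponent-≥ : ∀ M → 2 ^ n ℕ.≤ M → n ℕ.≤ proj₁ (dyadic-bracket M)
  exponent-≥ M 2^n≤M with dyadic-bracket M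
  ... | m , _ , hi with n ℕ.≤? m
  ... | yes n≤m = n≤m
  ... | no  n≰m = ⊥-elim (ℕP.<-irrefl refl
          (ℕP.<-≤-trans hi (ℕP.≤-trans (ℕP.^-monoʳ-≤ 2 (ℕP.≰⇒> n≰m)) (ℕP.m≤n⇒m≤1+n 2^n≤M))))
  small : ∀ M → 2 ^ n ℕ.≤ M → ∣ H1 M * H1 M * H1 M * inv (suc M) ∣ < ε
  small M 2^n≤M = <-respˡ-≡ (sym (0≤p⇒∣p∣≡p (nonneg-* (cube-nonneg (H1-nonneg M)) (inv-nonneg (suc M)))))
    (begin-strict
      H1 M * H1 M * H1 M * inv (suc M)          ≤⟨ harmonic-cube-bound M ⟩
      ℕ→ℚ 41 * inv (suc (proj₁ (dyadic-bracket M))) ≤⟨ *-monoˡ-≤-nonNeg (ℕ→ℚ 41) {{nonNegative (ℕ→ℚ-nonneg 41)}}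
                                                        (inv-antitone (exponent-≥ M 2^n≤M)) ⟩
      ℕ→ℚ 41 * inv (suc n)                      <⟨ *-monoʳ-<-pos (ℕ→ℚ 41) 1/[n+1]<ε/41 ⟩
      ℕ→ℚ 41 * (ε * inv 41)                     ≡⟨ cancel41 ε ⟩
      ε ∎)
    where open ≤-Reasoning

-- Elementary and complete homogeneous symmetric functions of 1, 1/2, …, 1/n:
--   e_q(n) = Σ_{i₁<…<i_q≤n} 1/(i₁⋯i_q),   h_q(n) = Σ_{i₁≤…≤i_q≤n} 1/(i₁⋯i_q),
-- given by their recursions in n.
eSym : ℕ → ℕ → ℚ
eSym zero    n       = 1ℚ
eSym (suc q) zero    = 0ℚ
eSym (suc q) (suc n) = eSym (suc q) n + eSym q n * inv (suc n)

hSym : ℕ → ℕ → ℚ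
hSym zero    n       = 1ℚ
hSym (suc q) zero    = 0ℚ
hSym (suc q) (suc n) = hSym (suc q) n + hSym q (suc n) * inv (suc n)

-- Newton's identities express q! e_q and q! h_q through the power sums H^{(j)}.
-- The numerators of the three series are A1 = e₁, A2 = 2 e₂, A3 = 6 e₃.
eSym-1 : ∀ n → eSym 1 n ≡ H1 n
eSym-1 zero    = refl
eSym-1 (suc n) = cong₂ _+_ (eSym-1 n) (trans (*-identityˡ (inv (suc n))) (sym (*-identityʳ (inv (suc n)))))

eSym-2 : ∀ n → ℕ→ℚ 2 * eSym 2 n ≡ A2 n
eSym-2 zero    = refl
eSym-2 (suc n) = combine₂ 1ℚ (ℕ→ℚ 2 * inv (suc n))
  (step (eSym 2 n) (eSym 1 n) (H1 n) (H 2 n) (inv (suc n))) (eSym-2 n) (eSym-1 n)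
  where
  step : ∀ E₂ E₁ h h₂ x → ℕ→ℚ 2 * (E₂ + E₁ * x) - ((h + x * 1ℚ) * (h + x * 1ℚ) - (h₂ + x * (x * 1ℚ)))
                          ≡ 1ℚ * (ℕ→ℚ 2 * E₂ - (h * h - h₂)) + ℕ→ℚ 2 * x * (E₁ - h)
  step = solve-∀ ℚ-ring

eSym-3 : ∀ n → ℕ→ℚ 6 * eSym 3 n ≡ A3 n
eSym-3 zero    = refl
eSym-3 (suc n) = combine₂ 1ℚ (ℕ→ℚ 3 * inv (suc n))
  (step (eSym 3 n) (eSym 2 n) (H1 n) (H 2 n) (H 3 n) (inv (suc n))) (eSym-3 n) (eSym-2 n)
  where
  step : ∀ E₃ E₂ h h₂ h₃ x → ℕ→ℚ 6 * (E₃ + E₂ * x)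
        - ((h + x * 1ℚ) * (h + x * 1ℚ) * (h + x * 1ℚ) - ℕ→ℚ 3 * (h + x * 1ℚ) * (h₂ + x * (x * 1ℚ))
           + ℕ→ℚ 2 * (h₃ + x * (x * (x * 1ℚ))))
      ≡ 1ℚ * (ℕ→ℚ 6 * E₃ - (h * h * h - ℕ→ℚ 3 * h * h₂ + ℕ→ℚ 2 * h₃)) + ℕ→ℚ 3 * x * (ℕ→ℚ 2 * E₂ - (h * h - h₂))
  step = solve-∀ ℚ-ring

-- The cycle-index polynomials appearing on the right-hand sides:
-- 2 h₂ = Z₂, 6 h₃ = Z₃, 24 h₄ = Z₄ (evaluated at H_K^{(j)}).
Z₂ Z₃ Z₄ : ℕ → ℚ
Z₂ K = H1 K * H1 K + H 2 K
Z₃ K = H1 K * H1 K * H1 K + ℕ→ℚ 3 * H1 K * H 2 K + ℕ→ℚ 2 * H 3 K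
Z₄ K = H1 K * H1 K * H1 K * H1 K + ℕ→ℚ 8 * H1 K * H 3 K
       + ℕ→ℚ 6 * (H1 K * H1 K) * H 2 K + ℕ→ℚ 3 * (H 2 K * H 2 K) + ℕ→ℚ 6 * H 4 K

hSym-1 : ∀ n → hSym 1 n ≡ H1 n
hSym-1 zero    = refl
hSym-1 (suc n) = cong₂ _+_ (hSym-1 n) (trans (*-identityˡ (inv (suc n))) (sym (*-identityʳ (inv (suc n)))))

hSym-2 : ∀ n → ℕ→ℚ 2 * hSym 2 n ≡ Z₂ n
hSym-2 zero    = refl
hSym-2 (suc n) = combine₂ 1ℚ (ℕ→ℚ 2 * inv (suc n))
  (step (hSym 2 n) (hSym 1 (suc n)) (H1 n) (H 2 n) (inv (suc n))) (hSym-2 n) (hSym-1 (suc n))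
  where
  step : ∀ E₂ E₁ h h₂ x → ℕ→ℚ 2 * (E₂ + E₁ * x) - ((h + x * 1ℚ) * (h + x * 1ℚ) + (h₂ + x * (x * 1ℚ)))
                          ≡ 1ℚ * (ℕ→ℚ 2 * E₂ - (h * h + h₂)) + ℕ→ℚ 2 * x * (E₁ - (h + x * 1ℚ))
  step = solve-∀ ℚ-ring

hSym-3 : ∀ n → ℕ→ℚ 6 * hSym 3 n ≡ Z₃ n
hSym-3 zero    = refl
hSym-3 (suc n) = combine₂ 1ℚ (ℕ→ℚ 3 * inv (suc n))
  (step (hSym 3 n) (hSym 2 (suc n)) (H1 n) (H 2 n) (H 3 n) (inv (suc n))) (hSym-3 n) (hSym-2 (suc n))
  where
  step : ∀ E₃ E₂ h h₂ h₃ x → ℕ→ℚ 6 * (E₃ + E₂ * x)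
        - ((h + x * 1ℚ) * (h + x * 1ℚ) * (h + x * 1ℚ) + ℕ→ℚ 3 * (h + x * 1ℚ) * (h₂ + x * (x * 1ℚ))
           + ℕ→ℚ 2 * (h₃ + x * (x * (x * 1ℚ))))
      ≡ 1ℚ * (ℕ→ℚ 6 * E₃ - (h * h * h + ℕ→ℚ 3 * h * h₂ + ℕ→ℚ 2 * h₃))
        + ℕ→ℚ 3 * x * (ℕ→ℚ 2 * E₂ - ((h + x * 1ℚ) * (h + x * 1ℚ) + (h₂ + x * (x * 1ℚ))))
  step = solve-∀ ℚ-ring

hSym-4 : ∀ n → ℕ→ℚ 24 * hSym 4 n ≡ Z₄ n
hSym-4 zero    = refl
hSym-4 (suc n) = combine₂ 1ℚ (ℕ→ℚ 4 * inv (suc n))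
  (step (hSym 4 n) (hSym 3 (suc n)) (H1 n) (H 2 n) (H 3 n) (H 4 n) (inv (suc n))) (hSym-4 n) (hSym-3 (suc n))
  where
  step : ∀ E₄ E₃ h h₂ h₃ h₄ x → ℕ→ℚ 24 * (E₄ + E₃ * x)
        - ((h + x * 1ℚ) * (h + x * 1ℚ) * (h + x * 1ℚ) * (h + x * 1ℚ) + ℕ→ℚ 8 * (h + x * 1ℚ) * (h₃ + x * (x * (x * 1ℚ)))
           + ℕ→ℚ 6 * ((h + x * 1ℚ) * (h + x * 1ℚ)) * (h₂ + x * (x * 1ℚ)) + ℕ→ℚ 3 * ((h₂ + x * (x * 1ℚ)) * (h₂ + x * (x * 1ℚ)))
           + ℕ→ℚ 6 * (h₄ + x * (x * (x * (x * 1ℚ)))))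
      ≡ 1ℚ * (ℕ→ℚ 24 * E₄ - (h * h * h * h + ℕ→ℚ 8 * h * h₃ + ℕ→ℚ 6 * (h * h) * h₂ + ℕ→ℚ 3 * (h₂ * h₂) + ℕ→ℚ 6 * h₄))
        + ℕ→ℚ 4 * x * (ℕ→ℚ 6 * E₃ - ((h + x * 1ℚ) * (h + x * 1ℚ) * (h + x * 1ℚ) + ℕ→ℚ 3 * (h + x * 1ℚ) * (h₂ + x * (x * 1ℚ))
                                      + ℕ→ℚ 2 * (h₃ + x * (x * (x * 1ℚ)))))
  step = solve-∀ ℚ-ring

-- Size of e_q: 0 ≤ e_q(n) ≤ H_n^q (expand (1 + … + 1/n)^q), hence ≤ H_n³ for q ≤ 3.
power : ℚ → ℕ → ℚ
power x zero    = 1ℚ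
power x (suc q) = x * power x q

power-nonneg : ∀ {x} q → 0ℚ ≤ x → 0ℚ ≤ power x q
power-nonneg zero    _   = 0≤1
power-nonneg (suc q) 0≤x = nonneg-* 0≤x (power-nonneg q 0≤x)

power-mono : ∀ {a b} q → 0ℚ ≤ a → a ≤ b → power a q ≤ power b q
power-mono zero    _   _   = ≤-refl
power-mono (suc q) 0≤a a≤b = *-mono-≤-nonneg 0≤a (power-nonneg q 0≤a) a≤b (power-mono q 0≤a a≤b)

-- Keeping two terms of the binomial expansion:  h^{q+1} + h^q x ≤ (h+x)^{q+1}  for h, x ≥ 0.
power-binomial : ∀ {h x} q → 0ℚ ≤ h → 0ℚ ≤ x → power h (suc q) + power h q * x ≤ power (h + x) (suc q)
power-binomial {h} {x} zero _ _ = ≤-reflexive (expand h x)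
  where
  expand : ∀ h x → h * 1ℚ + 1ℚ * x ≡ (h + x) * 1ℚ
  expand = solve-∀ ℚ-ring
power-binomial {h} {x} (suc q) 0≤h 0≤x = begin
    power h (suc (suc q)) + power h (suc q) * x
      ≤⟨ ≤-trans (≤-reflexive (sym (+-identityʳ _))) (+-monoʳ-≤ (power h (suc (suc q)) + power h (suc q) * x) dropped-terms) ⟩
    (power h (suc (suc q)) + power h (suc q) * x) + (x * power h (suc q) + x * x * power h q)
      ≡⟨ expand h x (power h q) ⟩
    (h + x) * (power h (suc q) + power h q * x)
      ≤⟨ *-monoˡ-≤-nonNeg (h + x) {{nonNegative (nonneg-+ 0≤h 0≤x)}} (power-binomial q 0≤h 0≤x) ⟩
    power (h + x) (suc (suc q)) ∎
  where
  open ≤-Reasoning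
  dropped-terms : 0ℚ ≤ x * power h (suc q) + x * x * power h q
  dropped-terms = nonneg-+ (nonneg-* 0≤x (power-nonneg (suc q) 0≤h)) (nonneg-* (nonneg-* 0≤x 0≤x) (power-nonneg q 0≤h))
  expand : ∀ h x P → (h * (h * P) + (h * P) * x) + (x * (h * P) + x * x * P) ≡ (h + x) * ((h * P) + P * x)
  expand = solve-∀ ℚ-ring

eSym-nonneg : ∀ q n → 0ℚ ≤ eSym q n
eSym-nonneg zero    n       = 0≤1
eSym-nonneg (suc q) zero    = ≤-refl
eSym-nonneg (suc q) (suc n) = nonneg-+ (eSym-nonneg (suc q) n) (nonneg-* (eSym-nonneg q n) (inv-nonneg (suc n)))

eSym≤power : ∀ q n → eSym q n ≤ power (H1 n) q
eSym≤power zero    n       = ≤-refl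
eSym≤power (suc q) zero    = ≤-reflexive (sym (*-zeroˡ (power 0ℚ q)))
eSym≤power (suc q) (suc n) = begin
    eSym (suc q) n + eSym q n * inv (suc n)
      ≤⟨ +-mono-≤ (eSym≤power (suc q) n) (*-monoʳ-≤-nonNeg (inv (suc n)) {{nonNegative (inv-nonneg (suc n))}} (eSym≤power q n)) ⟩
    power (H1 n) (suc q) + power (H1 n) q * inv (suc n)
      ≤⟨ power-binomial q (H1-nonneg n) (inv-nonneg (suc n)) ⟩
    power (H1 n + inv (suc n)) (suc q)
      ≡⟨ cong (λ w → power (H1 n + w) (suc q)) (sym (*-identityʳ (inv (suc n)))) ⟩
    power (H1 (suc n)) (suc q) ∎
  where open ≤-Reasoning

power≤cube : ∀ {h} q → q ℕ.≤ 3 → 1ℚ ≤ h → power h q ≤ h * h * h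
power≤cube {h} q q≤3 1≤h = ≤-trans (up-to-3 q q≤3) (≤-reflexive (cube h))
  where
  0≤h = ≤-trans 0≤1 1≤h
  up : ∀ q → power h q ≤ power h (suc q)
  up q = ≤-trans (≤-reflexive (sym (*-identityˡ (power h q))))
                 (*-monoʳ-≤-nonNeg (power h q) {{nonNegative (power-nonneg q 0≤h)}} 1≤h)
  up-to-3 : ∀ q → q ℕ.≤ 3 → power h q ≤ power h 3
  up-to-3 0 _ = ≤-trans (up 0) (≤-trans (up 1) (up 2))
  up-to-3 1 _ = ≤-trans (up 1) (up 2)
  up-to-3 2 _ = up 2
  up-to-3 3 _ = ≤-refl
  up-to-3 (suc (suc (suc (suc q)))) (ℕ.s≤s (ℕ.s≤s (ℕ.s≤s ())))
  cube : ∀ h → h * (h * (h * 1ℚ)) ≡ h * h * h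
  cube = solve-∀ ℚ-ring

-- The tail terms e_q(M-1)/(M+K+1) are null for q ≤ 3, being dominated by H_M³/(M+1).
tail-null : ∀ q K → q ℕ.≤ 3 → TendsToZero (λ M → eSym q (M ∸ 1) * inv (M ℕ.+ suc K))
tail-null q K q≤3 = null-bounded 1 bound harmonic-cube-null
  where
  bound : ∀ M → 1 ℕ.≤ M → ∣ eSym q (M ∸ 1) * inv (M ℕ.+ suc K) ∣ ≤ H1 M * H1 M * H1 M * inv (suc M)
  bound (suc m) _ = begin
      ∣ eSym q m * inv (suc m ℕ.+ suc K) ∣  ≡⟨ 0≤p⇒∣p∣≡p (nonneg-* (eSym-nonneg q m) (inv-nonneg (suc m ℕ.+ suc K))) ⟩
      eSym q m * inv (suc m ℕ.+ suc K)
        ≤⟨ *-mono-≤-nonneg (eSym-nonneg q m) (inv-nonneg (suc m ℕ.+ suc K)) e≤H³ 1/[m+K+2]≤1/[m+2] ⟩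
      H1 (suc m) * H1 (suc m) * H1 (suc m) * inv (suc (suc m)) ∎
    where
    open ≤-Reasoning
    e≤H³ : eSym q m ≤ H1 (suc m) * H1 (suc m) * H1 (suc m)
    e≤H³ = ≤-trans (eSym≤power q m) (≤-trans (power-mono q (H1-nonneg m) (H1-≤-suc m)) (power≤cube q q≤3 (H1≥1 m)))
    1/[m+K+2]≤1/[m+2] : inv (suc m ℕ.+ suc K) ≤ inv (suc (suc m))
    1/[m+K+2]≤1/[m+2] = subst (λ w → inv w ≤ inv (suc (suc m))) (sym (ℕP.+-suc (suc m) K))
      (inv-antitone (ℕ.s≤s (ℕP.m≤m+n m K)))

-- U_q(K,M) = Σ_{n≤M} e_q(n-1) (1/n - 1/(n+K)).  Its limit as M → ∞ is h_{q+1}(K).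
U : ℕ → ℕ → ℕ → ℚ
U q K M = Σ₁ M (λ n → eSym q (n ∸ 1) * (inv n - inv (n ℕ.+ K)))

U-zero : ∀ q M → U q 0 M ≡ 0ℚ
U-zero q M = trans (Σ-cong M vanish) (Σ-zero M)
  where
  vanish : ∀ i → i ℕ.< M → eSym q i * (inv (suc i) - inv (suc i ℕ.+ 0)) ≡ 0ℚ
  vanish i _ = trans (cong (λ w → eSym q i * (inv (suc i) - inv w)) (ℕP.+-identityʳ (suc i)))
    (trans (cong (eSym q i *_) (+-inverseʳ (inv (suc i)))) (*-zeroʳ (eSym q i)))

-- Raising K by one adds the term 1/(K+1) up to a tail (telescoping for q = 0) …
U-step₀ : ∀ K M → U 0 (suc K) M ≡ U 0 K M + inv (suc K) - inv (M ℕ.+ suc K)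
U-step₀ K zero = sym (cancel (inv (suc K)))
  where
  cancel : ∀ x → 0ℚ + x - x ≡ 0ℚ
  cancel = solve-∀ ℚ-ring
U-step₀ K (suc M) = trans (cong (_+ 1ℚ * (inv (suc M) - inv (suc M ℕ.+ suc K))) (U-step₀ K M))
   (combine₁ 1ℚ (rearrange (U 0 K M) (inv (suc K)) c c′ (inv (suc M)) (inv (suc M ℕ.+ suc K)))
      (cong inv (sym (ℕP.+-suc M K))))
  where
  c = inv (M ℕ.+ suc K)
  c′ = inv (suc M ℕ.+ K)
  rearrange : ∀ u x c c′ a d → (u + x - c + 1ℚ * (a - d)) - (u + 1ℚ * (a - c′) + x - d) ≡ 1ℚ * (c′ - c)
  rearrange = solve-∀ ℚ-ring

-- … and for q ≥ 1 it adds (1/(K+1)) U_{q-1}(K+1, M-1), again up to a tail.  The key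
-- is the partial-fraction identity  (1/n)(1/(n+K+1)) = (1/(K+1))(1/n - 1/(n+K+1)).
U-step : ∀ q K M → U (suc q) (suc K) M
                ≡ U (suc q) K M + inv (suc K) * U q (suc K) (M ∸ 1) - eSym (suc q) (M ∸ 1) * inv (M ℕ.+ suc K)
-- for M ≤ 1 all terms vanish, since e_{q+1}(0) = 0
U-step q K zero = sym (cancel (inv (suc K)) (inv (suc K)))
  where
  cancel : ∀ x y → 0ℚ + x * 0ℚ - 0ℚ * y ≡ 0ℚ
  cancel = solve-∀ ℚ-ring
U-step q K (suc zero) = trans (cong (_+ eSym (suc q) 0 * (inv 1 - inv (1 ℕ.+ suc K))) (U-step q K zero))
   (zeros (inv 1) (inv (suc (suc K))) (inv (suc K)) (inv (suc K)) (inv (suc K)))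
  where
  zeros : ∀ a d d′ c x → 0ℚ + x * 0ℚ - 0ℚ * c + 0ℚ * (a - d) ≡ 0ℚ + 0ℚ * (a - d′) + x * 0ℚ - 0ℚ * d
  zeros = solve-∀ ℚ-ring
U-step q K (suc (suc m)) =
  trans (cong (_+ eSym (suc q) (suc m) * (inv (suc (suc m)) - inv (suc (suc m) ℕ.+ suc K))) (U-step q K (suc m)))
    (combine₂ (eSym q m) (eSym (suc q) m + eSym q m * a)
      (rearrange (U (suc q) K (suc m)) (U q (suc K) m) (eSym (suc q) m) (eSym q m) a b c c′ d x)
      (product-as-difference a c x (partial-fractions m K)) (cong inv (sym (ℕP.+-suc (suc m) K))))
  where
  a = inv (suc m)
  b = inv (suc (suc m))
  c = inv (suc m ℕ.+ suc K)
  c′ = inv (suc (suc m) ℕ.+ K)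
  d = inv (suc (suc m) ℕ.+ suc K)
  x = inv (suc K)
  rearrange : ∀ u v E E′ a b c c′ d x →
      (u + x * v - E * c) + (E + E′ * a) * (b - d)
      - ((u + (E + E′ * a) * (b - c′)) + x * (v + E′ * (a - c)) - (E + E′ * a) * d)
      ≡ E′ * (a * c - x * (a - c)) + (E + E′ * a) * (c′ - c)
  rearrange = solve-∀ ℚ-ring

-- U_q(K,·) → h_{q+1}(K) for q ≤ 3, by induction on K using the two steps above;
-- the recursion of h_{q+1} in K mirrors them exactly.
U-limit : ∀ q K → q ℕ.≤ 3 → TendsToZero (λ M → U q K M - hSym (suc q) K)
U-limit q zero _ = null-cong (λ M → sym (trans (cong (_- 0ℚ) (U-zero q M)) (+-inverseʳ 0ℚ))) null-zero
U-limit zero (suc K) _ = null-cong regroup (null-- (U-limit 0 K ℕ.z≤n) (tail-null 0 K ℕ.z≤n))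
  where
  x = inv (suc K)
  regroup : ∀ M → (U 0 K M - hSym 1 K) - eSym 0 (M ∸ 1) * inv (M ℕ.+ suc K) ≡ U 0 (suc K) M - hSym 1 (suc K)
  regroup M = sym (trans (cong (_- (hSym 1 K + 1ℚ * x)) (U-step₀ K M)) (identity (U 0 K M) (hSym 1 K) x (inv (M ℕ.+ suc K))))
    where
    identity : ∀ u h x c → u + x - c - (h + 1ℚ * x) ≡ (u - h) - 1ℚ * c
    identity = solve-∀ ℚ-ring
U-limit (suc q) (suc K) q<3 =
  null-cong regroup (null-- (null-+ (U-limit (suc q) K q<3)
                                    (null-scale x (∣inv∣≤1 (suc K)) (null-shift (U-limit q (suc K) (ℕP.<⇒≤ q<3)))))
                            (tail-null (suc q) K q<3))
  where
  x = inv (suc K)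
  regroup : ∀ M → ((U (suc q) K M - hSym (suc (suc q)) K) + x * (U q (suc K) (M ∸ 1) - hSym (suc q) (suc K)))
                   - eSym (suc q) (M ∸ 1) * inv (M ℕ.+ suc K)
                 ≡ U (suc q) (suc K) M - hSym (suc (suc q)) (suc K)
  regroup M = sym (trans (cong (_- (hSym (suc (suc q)) K + hSym (suc q) (suc K) * x)) (U-step q K M))
     (identity (U (suc q) K M) (U q (suc K) (M ∸ 1)) (eSym (suc q) (M ∸ 1)) (inv (M ℕ.+ suc K))
               (hSym (suc (suc q)) K) (hSym (suc q) (suc K)) x))
    where
    identity : ∀ u v E c h₁ h₂ x → u + x * v - E * c - (h₁ + h₂ * x) ≡ ((u - h₁) + x * (v - h₂)) - E * c
    identity = solve-∀ ℚ-ring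

-- Then Σ_{n≤M} e_p(n-1)/n² - H_M^{(p+2)} equals 0, -W(1/n²) M and -W(H_n/n²) M
-- for p = 0, 1, 2; W is bounded by a multiple of H_M³/(M+1).
W : (ℕ → ℚ) → ℕ → ℚ
W g M = Σ₁ M (λ n → (H1 M - H1 (M ∸ n)) * g n)

Conv : (ℕ → ℚ) → ℕ → ℚ
Conv g M = Σ₁ M (λ n → g n * inv (suc M ∸ n))

complement-suc : ∀ i M → i ℕ.< M → M ∸ i ≡ suc (M ∸ suc i)
complement-suc i M i<M = ℕP.+-∸-assoc 1 {M} {suc i} i<M

-- Passing from M to M+1 every difference H_{M+1} - H_{M+1-n} changes by 1/(M+1) - 1/(M+1-n).
W-step : ∀ g M → W g (suc M) ≡ (W g M + inv (suc M) * Σ₁ M g - Conv g M) + H1 (suc M) * g (suc M)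
W-step g M = begin
    Σ₁ M (λ n → (H1 (suc M) - H1 (suc M ∸ n)) * g n) + (H1 (suc M) - H1 (suc M ∸ suc M)) * g (suc M)
      ≡⟨ cong₂ _+_ (Σ-cong M term) (cong (λ w → (H1 (suc M) - H1 w) * g (suc M)) (ℕP.n∸n≡0 M)) ⟩
    Σ₁ M (λ n → ((H1 M - H1 (M ∸ n)) * g n + x * g n) - g n * inv (suc M ∸ n)) + (H1 (suc M) - 0ℚ) * g (suc M)
      ≡⟨ cong (_+ ((H1 (suc M) - 0ℚ) * g (suc M))) (trans (Σ-- M _ _)
           (cong (_- Conv g M) (trans (Σ-+ M _ _) (cong (λ z → W g M + z) (Σ-*ˡ M x g))))) ⟩
    (W g M + x * Σ₁ M g - Conv g M) + (H1 (suc M) - 0ℚ) * g (suc M)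
      ≡⟨ cong (λ z → (W g M + x * Σ₁ M g - Conv g M) + z * g (suc M)) (+-identityʳ (H1 (suc M))) ⟩
    (W g M + x * Σ₁ M g - Conv g M) + H1 (suc M) * g (suc M) ∎
  where
  open ≡-Reasoning
  x = inv (suc M)
  split : ∀ h x h′ y G → (h + x * 1ℚ - (h′ + y * 1ℚ)) * G ≡ ((h - h′) * G + x * G) - G * y
  split = solve-∀ ℚ-ring
  term : ∀ i → i ℕ.< M → (H1 (suc M) - H1 (M ∸ i)) * g (suc i)
                        ≡ ((H1 M - H1 (M ∸ suc i)) * g (suc i) + x * g (suc i)) - g (suc i) * inv (M ∸ i)
  term i i<M rewrite complement-suc i M i<M = split (H1 M) x (H1 (M ∸ suc i)) (inv (suc (M ∸ suc i))) (g (suc i))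

-- Partial fractions for complementary indices n + (M+1-n) = M+1.
partial-fractions-complement : ∀ M i → i ℕ.< M →
  inv (suc i) * inv (suc M ∸ suc i) ≡ inv (suc M) * (inv (suc i) + inv (suc M ∸ suc i))
partial-fractions-complement M i i<M rewrite complement-suc i M i<M =
  trans (partial-fractions i (M ∸ suc i)) (cong (λ w → inv w * (inv (suc i) + inv (suc (M ∸ suc i)))) sum≡)
  where
  sum≡ : suc i ℕ.+ suc (M ∸ suc i) ≡ suc M
  sum≡ = cong suc (trans (ℕP.+-suc i (M ∸ suc i)) (ℕP.m+[n∸m]≡n i<M))

Σ-inv : ∀ M → Σ₁ M inv ≡ H1 M
Σ-inv M = Σ-cong M (λ i _ → sym (*-identityʳ (inv (suc i))))

Conv-inv : ∀ M → Conv inv M ≡ inv (suc M) * (H1 M + H1 M)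
Conv-inv M = begin
    Σ₁ M (λ n → inv n * inv (suc M ∸ n))         ≡⟨ Σ-cong M (partial-fractions-complement M) ⟩
    Σ₁ M (λ n → x * (inv n + inv (suc M ∸ n)))   ≡⟨ Σ-*ˡ M x _ ⟩
    x * Σ₁ M (λ n → inv n + inv (suc M ∸ n))     ≡⟨ cong (x *_) (Σ-+ M inv (λ n → inv (suc M ∸ n))) ⟩
    x * (Σ₁ M inv + Σ₁ M (λ n → inv (suc M ∸ n))) ≡⟨ cong (λ w → x * (Σ₁ M inv + w)) (sym (Σ-reflect M inv)) ⟩
    x * (Σ₁ M inv + Σ₁ M inv)                     ≡⟨ cong (λ w → x * (w + w)) (Σ-inv M) ⟩
    x * (H1 M + H1 M) ∎
  where
  open ≡-Reasoning
  x = inv (suc M)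

inv² : ℕ → ℚ
inv² n = inv n * inv n

H/n² : ℕ → ℚ
H/n² n = H1 n * (inv n * inv n)

Σ-inv² : ∀ M → Σ₁ M inv² ≡ H 2 M
Σ-inv² M = Σ-cong M (λ i _ → cong (inv (suc i) *_) (sym (*-identityʳ (inv (suc i)))))

Conv-inv² : ∀ M → Conv inv² M ≡ inv (suc M) * H 2 M + inv (suc M) * inv (suc M) * (H1 M + H1 M)
Conv-inv² M = begin
    Conv inv² M
      ≡⟨ Σ-cong M term ⟩
    Σ₁ M (λ n → x * inv² n + x * x * (inv n + inv (suc M ∸ n)))
      ≡⟨ Σ-+ M _ _ ⟩
    Σ₁ M (λ n → x * inv² n) + Σ₁ M (λ n → x * x * (inv n + inv (suc M ∸ n)))
      ≡⟨ cong₂ _+_ (trans (Σ-*ˡ M x inv²) (cong (x *_) (Σ-inv² M)))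
                   (trans (Σ-*ˡ M (x * x) _) (cong (x * x *_) (trans (Σ-+ M inv (λ n → inv (suc M ∸ n)))
                     (trans (cong (λ w → Σ₁ M inv + w) (sym (Σ-reflect M inv))) (cong (λ w → w + w) (Σ-inv M)))))) ⟩
    x * H 2 M + x * x * (H1 M + H1 M) ∎
  where
  open ≡-Reasoning
  x = inv (suc M)
  identity : ∀ A B x → A * A * B - (x * (A * A) + x * x * (A + B)) ≡ (A + x) * (A * B - x * (A + B))
  identity = solve-∀ ℚ-ring
  term : ∀ i → i ℕ.< M → inv² (suc i) * inv (suc M ∸ suc i)
                        ≡ x * inv² (suc i) + x * x * (inv (suc i) + inv (suc M ∸ suc i))
  term i i<M = combine₁ (inv (suc i) + x) (identity (inv (suc i)) (inv (suc M ∸ suc i)) x)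
                        (partial-fractions-complement M i i<M)

Σ-H/n : ℕ → ℚ
Σ-H/n M = Σ₁ M (λ n → H1 n * inv n)

Σ-H/n≡ : ∀ M → ℕ→ℚ 2 * Σ-H/n M ≡ H1 M * H1 M + H 2 M
Σ-H/n≡ zero    = refl
Σ-H/n≡ (suc M) = combine₁ 1ℚ (step (Σ-H/n M) (H1 M) (H 2 M) (inv (suc M))) (Σ-H/n≡ M)
  where
  step : ∀ S h h₂ x → ℕ→ℚ 2 * (S + (h + x * 1ℚ) * x) - ((h + x * 1ℚ) * (h + x * 1ℚ) + (h₂ + x * (x * 1ℚ)))
                      ≡ 1ℚ * (ℕ→ℚ 2 * S - (h * h + h₂))
  step = solve-∀ ℚ-ring

Conv-H : ℕ → ℚ
Conv-H M = Σ₁ M (λ n → H1 n * inv (suc M ∸ n))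

Conv-H-reflected : ℕ → ℚ
Conv-H-reflected M = Σ₁ M (λ m → H1 (suc M ∸ m) * inv m)

Conv-H-reflect : ∀ M → Conv-H M ≡ Conv-H-reflected M
Conv-H-reflect M = trans (Σ-reflect M (λ n → H1 n * inv (suc M ∸ n)))
  (Σ-cong M (λ j j<M → cong (λ w → H1 (suc M ∸ suc j) * inv w) (ℕP.m∸[m∸n]≡n {suc M} {suc j} (ℕ.s≤s (ℕP.<⇒≤ j<M)))))

-- The sum Σ_{m≤M} (1/m)(1/(M+2-m)), i.e. Conv inv (M+1) without its last term.
Conv-inv-truncated : ℕ → ℚ
Conv-inv-truncated M = Σ₁ M (λ m → inv m * inv (suc (suc M) ∸ m))

Conv-inv-truncated≡ : ∀ M → Conv-inv-truncated M + inv (suc M) ≡ inv (suc (suc M)) * (H1 (suc M) + H1 (suc M))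
Conv-inv-truncated≡ M = trans (cong (λ z → Conv-inv-truncated M + z) (sym last-term)) (Conv-inv (suc M))
  where
  last-term : inv (suc M) * inv (suc (suc M) ∸ suc M) ≡ inv (suc M)
  last-term = trans (cong (λ w → inv (suc M) * inv w) (ℕP.m+n∸n≡m 1 M)) (*-identityʳ (inv (suc M)))

Conv-H-reflected-step : ∀ M → Conv-H-reflected (suc M) ≡ Conv-H-reflected M + Conv-inv-truncated M + inv (suc M)
Conv-H-reflected-step M = cong₂ _+_ (trans (Σ-cong M term) (Σ-+ M _ _))
  (trans (cong (λ w → H1 w * inv (suc M)) (ℕP.m+n∸n≡m 1 M)) (*-identityˡ (inv (suc M))))
  where
  split : ∀ h y a → (h + y * 1ℚ) * a ≡ h * a + a * y
  split = solve-∀ ℚ-ring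
  term : ∀ i → i ℕ.< M → H1 (suc M ∸ i) * inv (suc i) ≡ H1 (M ∸ i) * inv (suc i) + inv (suc i) * inv (suc M ∸ i)
  term i i<M rewrite ℕP.+-∸-assoc 1 (ℕP.<⇒≤ i<M) = split (H1 (M ∸ i)) (inv (suc (M ∸ i))) (inv (suc i))

Conv-H≡ : ∀ M → Conv-H M ≡ H1 M * H1 M - H 2 M + ℕ→ℚ 2 * H1 M * inv (suc M)
Conv-H≡ M = trans (Conv-H-reflect M) (reflected M)
  where
  reflected : ∀ M → Conv-H-reflected M ≡ H1 M * H1 M - H 2 M + ℕ→ℚ 2 * H1 M * inv (suc M)
  reflected zero    = refl
  reflected (suc M) = trans (Conv-H-reflected-step M)
    (combine₂ 1ℚ 1ℚ (step (Conv-H-reflected M) (Conv-inv-truncated M) (H1 M) (H 2 M) (inv (suc M)) (inv (suc (suc M))))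
              (reflected M) (Conv-inv-truncated≡ M))
    where
    step : ∀ v E h h₂ x y → (v + E + x) - ((h + x * 1ℚ) * (h + x * 1ℚ) - (h₂ + x * (x * 1ℚ)) + ℕ→ℚ 2 * (h + x * 1ℚ) * y)
          ≡ 1ℚ * (v - (h * h - h₂ + ℕ→ℚ 2 * h * x)) + 1ℚ * ((E + x) - y * ((h + x * 1ℚ) + (h + x * 1ℚ)))
    step = solve-∀ ℚ-ring

Conv-H/n² : ∀ M → Conv H/n² M ≡ inv (suc M) * Σ₁ M H/n² + inv (suc M) * inv (suc M) * Σ-H/n M
                                + inv (suc M) * inv (suc M) * Conv-H M
Conv-H/n² M = begin
    Conv H/n² M
      ≡⟨ Σ-cong M term ⟩
    Σ₁ M (λ n → x * H/n² n + x * x * (H1 n * inv n) + x * x * (H1 n * inv (suc M ∸ n)))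
      ≡⟨ trans (Σ-+ M _ _) (cong₂ _+_ (Σ-+ M _ _) refl) ⟩
    Σ₁ M (λ n → x * H/n² n) + Σ₁ M (λ n → x * x * (H1 n * inv n)) + Σ₁ M (λ n → x * x * (H1 n * inv (suc M ∸ n)))
      ≡⟨ cong₂ _+_ (cong₂ _+_ (Σ-*ˡ M x H/n²) (Σ-*ˡ M (x * x) _)) (Σ-*ˡ M (x * x) _) ⟩
    x * Σ₁ M H/n² + x * x * Σ-H/n M + x * x * Conv-H M ∎
  where
  open ≡-Reasoning
  x = inv (suc M)
  identity : ∀ h A B x → h * (A * A) * B - (x * (h * (A * A)) + x * x * (h * A) + x * x * (h * B))
                         ≡ (h * (A + x)) * (A * B - x * (A + B))
  identity = solve-∀ ℚ-ring
  term : ∀ i → i ℕ.< M → H/n² (suc i) * inv (suc M ∸ suc i)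
           ≡ x * H/n² (suc i) + x * x * (H1 (suc i) * inv (suc i)) + x * x * (H1 (suc i) * inv (suc M ∸ suc i))
  term i i<M = combine₁ (H1 (suc i) * (inv (suc i) + x))
    (identity (H1 (suc i)) (inv (suc i)) (inv (suc M ∸ suc i)) x) (partial-fractions-complement M i i<M)

EulerDefect : ℕ → ℕ → ℚ
EulerDefect p M = Σ₁ M (λ n → eSym p (n ∸ 1) * (inv n * inv n)) - H (suc (suc p)) M

EulerDefect-0 : ∀ M → EulerDefect 0 M ≡ 0ℚ
EulerDefect-0 M = trans (cong (_- H 2 M) (Σ-cong M term)) (+-inverseʳ (H 2 M))
  where
  term : ∀ i → i ℕ.< M → 1ℚ * (inv (suc i) * inv (suc i)) ≡ inv (suc i) * (inv (suc i) * 1ℚ)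
  term i _ = trans (*-identityˡ _) (cong (inv (suc i) *_) (sym (*-identityʳ (inv (suc i)))))

EulerDefect-1 : ∀ M → EulerDefect 1 M ≡ - W inv² M
EulerDefect-1 zero    = refl
EulerDefect-1 (suc M) = trans
  (combine₄ 1ℚ (x * x) x (- 1ℚ)
    (step (Σ₁ M (λ n → eSym 1 (n ∸ 1) * (inv n * inv n))) (H 3 M) (W inv² M) (eSym 1 M) (H1 M) (Σ₁ M inv²) (H 2 M) (Conv inv² M) x)
    (EulerDefect-1 M) (eSym-1 M) (Σ-inv² M) (Conv-inv² M))
  (cong -_ (sym (W-step inv² M)))
  where
  x = inv (suc M)
  step : ∀ S h₃ w E h G h₂ C x →
    (S + E * (x * x)) - (h₃ + x * (x * (x * 1ℚ))) - - ((w + x * G - C) + (h + x * 1ℚ) * (x * x))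
    ≡ 1ℚ * ((S - h₃) - - w) + x * x * (E - h) + x * (G - h₂) + - 1ℚ * (C - (x * h₂ + x * x * (h + h)))
  step = solve-∀ ℚ-ring

EulerDefect-2 : ∀ M → EulerDefect 2 M ≡ - W H/n² M
EulerDefect-2 zero    = refl
EulerDefect-2 (suc M) = trans
  (combine₅ 1ℚ (x * x * inv 2) (- 1ℚ) (- (x * x * inv 2)) (- (x * x))
    (step (Σ₁ M (λ n → eSym 2 (n ∸ 1) * (inv n * inv n))) (H 4 M) (W H/n² M) (eSym 2 M) (H1 M) (H 2 M)
          (Σ₁ M H/n²) (Conv H/n² M) (Σ-H/n M) (Conv-H M) x)
    (EulerDefect-2 M) (eSym-2 M) (Conv-H/n² M) (Σ-H/n≡ M) (Conv-H≡ M))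
  (cong -_ (sym (W-step H/n² M)))
  where
  x = inv (suc M)
  step : ∀ S h₄ w E h h₂ G C S₁ v x →
    (S + E * (x * x)) - (h₄ + x * (x * (x * (x * 1ℚ)))) - - ((w + x * G - C) + (h + x * 1ℚ) * ((h + x * 1ℚ) * (x * x)))
    ≡ 1ℚ * ((S - h₄) - - w) + x * x * inv 2 * (ℕ→ℚ 2 * E - (h * h - h₂)) + - 1ℚ * (C - (x * G + x * x * S₁ + x * x * v))
      + - (x * x * inv 2) * (ℕ→ℚ 2 * S₁ - (h * h + h₂)) + - (x * x) * (v - (h * h - h₂ + ℕ→ℚ 2 * h * x))
  step = solve-∀ ℚ-ring

-- A weight 0 ≤ g(n) ≤ Φ/n² on [1, M] gives 0 ≤ W g M ≤ Φ · 2H_M/(M+1), because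
-- H_M - H_{M-n} ≤ n/(M+1-n) and (n/(M+1-n))(1/n²) = (1/n)(1/(M+1-n)) sums to 2H_M/(M+1).
W-bound : ∀ (g : ℕ → ℚ) Φ M → (∀ n → 0ℚ ≤ g n) → (∀ i → i ℕ.< M → g (suc i) ≤ Φ * inv² (suc i)) →
          (0ℚ ≤ W g M) × (W g M ≤ Φ * (inv (suc M) * (H1 M + H1 M)))
W-bound g Φ M 0≤g g≤Φ/n² = Σ-nonneg M (λ i i<M → nonneg-* (gap-nonneg i) (0≤g (suc i))) ,
   ≤-trans (Σ-mono M term-bound) (≤-reflexive (trans (Σ-*ˡ M Φ (λ n → inv n * inv (suc M ∸ n))) (cong (Φ *_) (Conv-inv M))))
  where
  gap-nonneg : ∀ i → 0ℚ ≤ H1 M - H1 (M ∸ suc i)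
  gap-nonneg i = difference-nonneg (H1-mono (ℕP.m∸n≤m M (suc i)))
  gap-bound : ∀ i → i ℕ.< M → H1 M - H1 (M ∸ suc i) ≤ ℕ→ℚ (suc i) * inv (suc (M ∸ suc i))
  gap-bound i i<M = difference-≤ (subst (λ w → H1 w ≤ H1 (M ∸ suc i) + ℕ→ℚ (suc i) * inv (suc (M ∸ suc i)))
                                       (ℕP.m∸n+n≡m i<M) (harmonic-block (M ∸ suc i) (suc i)))
  regroup : ∀ N B Φ A → (N * B) * (Φ * (A * A)) ≡ Φ * (A * B) * (N * A)
  regroup = solve-∀ ℚ-ring
  term-bound : ∀ i → i ℕ.< M → (H1 M - H1 (M ∸ suc i)) * g (suc i) ≤ Φ * (inv (suc i) * inv (suc M ∸ suc i))
  term-bound i i<M = begin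
      (H1 M - H1 (M ∸ suc i)) * g (suc i)
        ≤⟨ *-mono-≤-nonneg (gap-nonneg i) (0≤g (suc i)) (gap-bound i i<M) (g≤Φ/n² i i<M) ⟩
      (ℕ→ℚ (suc i) * inv (suc (M ∸ suc i))) * (Φ * (inv (suc i) * inv (suc i)))
        ≡⟨ regroup (ℕ→ℚ (suc i)) (inv (suc (M ∸ suc i))) Φ (inv (suc i)) ⟩
      Φ * (inv (suc i) * inv (suc (M ∸ suc i))) * (ℕ→ℚ (suc i) * inv (suc i))
        ≡⟨ cong (Φ * (inv (suc i) * inv (suc (M ∸ suc i))) *_) (ℕ→ℚ*inv i) ⟩
      Φ * (inv (suc i) * inv (suc (M ∸ suc i))) * 1ℚ
        ≡⟨ *-identityʳ _ ⟩
      Φ * (inv (suc i) * inv (suc (M ∸ suc i)))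
        ≡⟨ cong (λ w → Φ * (inv (suc i) * inv w)) (sym (complement-suc i M i<M)) ⟩
      Φ * (inv (suc i) * inv (suc M ∸ suc i)) ∎
    where open ≤-Reasoning

W-null : ∀ (g Φ : ℕ → ℚ) → (∀ n → 0ℚ ≤ g n) → (∀ M i → i ℕ.< M → g (suc i) ≤ Φ M * inv² (suc i)) →
         (∀ m → Φ (suc m) ≤ H1 (suc m) * H1 (suc m)) → TendsToZero (W g)
W-null g Φ 0≤g g≤Φ/n² Φ≤H² = null-bounded 1 bound (null-scaleℕ 2 harmonic-cube-null)
  where
  double : ∀ Φ x h → Φ * (x * (h + h)) ≡ ℕ→ℚ 2 * (Φ * h * x)
  double = solve-∀ ℚ-ring
  bound : ∀ M → 1 ℕ.≤ M → ∣ W g M ∣ ≤ ℕ→ℚ 2 * (H1 M * H1 M * H1 M * inv (suc M))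
  bound (suc m) _ = begin
      ∣ W g M ∣                                ≡⟨ 0≤p⇒∣p∣≡p (proj₁ W-bounds) ⟩
      W g M                                    ≤⟨ proj₂ W-bounds ⟩
      Φ M * (inv (suc M) * (H1 M + H1 M))      ≡⟨ double (Φ M) (inv (suc M)) (H1 M) ⟩
      ℕ→ℚ 2 * (Φ M * H1 M * inv (suc M))      ≤⟨ *-monoˡ-≤-nonNeg (ℕ→ℚ 2) {{nonNegative (ℕ→ℚ-nonneg 2)}}
                                                   (*-monoʳ-≤-nonNeg (inv (suc M)) {{nonNegative (inv-nonneg (suc M))}}
                                                     (*-monoʳ-≤-nonNeg (H1 M) {{nonNegative (H1-nonneg M)}} (Φ≤H² m))) ⟩
      ℕ→ℚ 2 * (H1 M * H1 M * H1 M * inv (suc M)) ∎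
    where
    open ≤-Reasoning
    M = suc m
    W-bounds : (0ℚ ≤ W g M) × (W g M ≤ Φ M * (inv (suc M) * (H1 M + H1 M)))
    W-bounds = W-bound g (Φ M) M 0≤g (g≤Φ/n² M)

inv²-nonneg : ∀ n → 0ℚ ≤ inv² n
inv²-nonneg n = nonneg-* (inv-nonneg n) (inv-nonneg n)

EulerDefect-null : ∀ p → p ℕ.≤ 2 → TendsToZero (EulerDefect p)
EulerDefect-null 0 _ = null-cong (λ M → sym (EulerDefect-0 M)) null-zero
EulerDefect-null 1 _ = null-dominated 0 (λ M _ → ≤-reflexive (trans (cong ∣_∣ (EulerDefect-1 M)) (∣-p∣≡∣p∣ _)))
  (W-null inv² (λ _ → 1ℚ) inv²-nonneg (λ _ i _ → ≤-reflexive (sym (*-identityˡ (inv² (suc i)))))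
          (λ m → ≤-trans (H1≥1 m) (≤-square (H1≥1 m))))
EulerDefect-null 2 _ = null-dominated 0 (λ M _ → ≤-reflexive (trans (cong ∣_∣ (EulerDefect-2 M)) (∣-p∣≡∣p∣ _)))
  (W-null H/n² H1 (λ n → nonneg-* (H1-nonneg n) (inv²-nonneg n))
          (λ M i i<M → *-monoʳ-≤-nonNeg (inv² (suc i)) {{nonNegative (inv²-nonneg (suc i))}} (H1-mono i<M))
          (λ m → ≤-square (H1≥1 m)))
EulerDefect-null (suc (suc (suc p))) (ℕ.s≤s (ℕ.s≤s ()))

-- The series Σ e_p(n)/(n(n+K)) as a combination of U_{p+1}, U_p and the Euler-type sum,
-- obtained termwise from e_{p+1}(n) = e_{p+1}(n-1) + e_p(n-1)/n and
-- 1/(n(n+K)) = (1/K)(1/n - 1/(n+K)).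
series-split : ∀ p k M → let c = inv (suc k) in
  seriesPartial (eSym (suc p)) (suc k) M
    ≡ c * U (suc p) (suc k) M - c * (c * U p (suc k) M) + c * Σ₁ M (λ n → eSym p (n ∸ 1) * (inv n * inv n))
series-split p k M = begin
    Σ₁ M (λ n → eSym (suc p) n * inv (n ℕ.* (n ℕ.+ K)))
      ≡⟨ Σ-cong M term ⟩
    Σ₁ M (λ n → c * (eSym (suc p) (n ∸ 1) * δ n) - c * (c * (eSym p (n ∸ 1) * δ n)) + c * (eSym p (n ∸ 1) * (inv n * inv n)))
      ≡⟨ trans (Σ-+ M _ _) (cong₂ _+_ (Σ-- M _ _) refl) ⟩
    Σ₁ M (λ n → c * (eSym (suc p) (n ∸ 1) * δ n)) - Σ₁ M (λ n → c * (c * (eSym p (n ∸ 1) * δ n)))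
      + Σ₁ M (λ n → c * (eSym p (n ∸ 1) * (inv n * inv n)))
      ≡⟨ cong₂ _+_ (cong₂ _-_ (Σ-*ˡ M c _) (trans (Σ-*ˡ M c _) (cong (c *_) (Σ-*ˡ M c _)))) (Σ-*ˡ M c _) ⟩
    c * U (suc p) K M - c * (c * U p K M) + c * Σ₁ M (λ n → eSym p (n ∸ 1) * (inv n * inv n)) ∎
  where
  open ≡-Reasoning
  K = suc k
  c = inv K
  δ : ℕ → ℚ
  δ n = inv n - inv (n ℕ.+ K)
  identity : ∀ E E′ a b c → (E + E′ * a) * (a * b) - (c * (E * (a - b)) - c * (c * (E′ * (a - b))) + c * (E′ * (a * a)))
                          ≡ (E + E′ * a - c * E′) * (a * b - c * (a - b))
  identity = solve-∀ ℚ-ring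
  term : ∀ i → i ℕ.< M → eSym (suc p) (suc i) * inv (suc i ℕ.* (suc i ℕ.+ K))
           ≡ c * (eSym (suc p) i * δ (suc i)) - c * (c * (eSym p i * δ (suc i))) + c * (eSym p i * (inv (suc i) * inv (suc i)))
  term i _ = trans (cong (eSym (suc p) (suc i) *_) (inv-* (suc i) (suc i ℕ.+ K)))
    (combine₁ (eSym (suc p) i + eSym p i * inv (suc i) - c * eSym p i)
      (identity (eSym (suc p) i) (eSym p i) (inv (suc i)) (inv (suc i ℕ.+ K)) c)
      (product-as-difference (inv (suc i)) (inv (suc i ℕ.+ K)) c (partial-fractions i k)))

series-limit : ∀ p k → p ℕ.≤ 2 → let K = suc k ; c = inv K in
  TendsToZero (λ M → seriesPartial (eSym (suc p)) K M - c * (hSym (suc (suc p)) K - hSym (suc p) K * c + H (suc (suc p)) M))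
series-limit p k p≤2 =
  null-cong regroup (null-+ (null-- (null-scale c ∣c∣≤1 (U-limit (suc p) K (ℕ.s≤s p≤2)))
                                    (null-scale c ∣c∣≤1 (null-scale c ∣c∣≤1 (U-limit p K (ℕP.m≤n⇒m≤1+n p≤2)))))
                            (null-scale c ∣c∣≤1 (EulerDefect-null p p≤2)))
  where
  K = suc k
  c = inv K
  ∣c∣≤1 = ∣inv∣≤1 K
  identity : ∀ c u₁ h₂ u₀ h₁ S Z → (c * (u₁ - h₂) - c * (c * (u₀ - h₁))) + c * (S - Z)
                                  ≡ (c * u₁ - c * (c * u₀) + c * S) - c * (h₂ - h₁ * c + Z)
  identity = solve-∀ ℚ-ring
  regroup : ∀ M → (c * (U (suc p) K M - hSym (suc (suc p)) K) - c * (c * (U p K M - hSym (suc p) K))) + c * EulerDefect p M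
                 ≡ seriesPartial (eSym (suc p)) K M - c * (hSym (suc (suc p)) K - hSym (suc p) K * c + H (suc (suc p)) M)
  regroup M = trans (identity c (U (suc p) K M) (hSym (suc (suc p)) K) (U p K M) (hSym (suc p) K)
                              (Σ₁ M (λ n → eSym p (n ∸ 1) * (inv n * inv n))) (H (suc (suc p)) M))
    (cong (_- c * (hSym (suc (suc p)) K - hSym (suc p) K * c + H (suc (suc p)) M)) (sym (series-split p k M)))

seriesPartial-scale : ∀ {a b : ℕ → ℚ} r K M → (∀ n → a n ≡ r * b n) → seriesPartial a K M ≡ r * seriesPartial b K M
seriesPartial-scale r K M a≡rb =
  trans (Σ-cong M (λ i _ → trans (cong (_* inv (suc i ℕ.* (suc i ℕ.+ K))) (a≡rb (suc i))) (*-assoc r _ _))) (Σ-*ˡ M r _)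

-- The three formulas of the corollary are the cases p = 0, 1, 2 of `series-limit`,
-- rewritten with A1 = e₁, A2 = 2e₂, A3 = 6e₃ and 2h₂ = Z₂, 6h₃ = Z₃, 24h₄ = Z₄.
formula₁ : ∀ k M → let K = suc k ; c = inv K in
  seriesPartial (eSym 1) K M - c * (hSym 2 K - hSym 1 K * c + H 2 M)
  ≡ seriesPartial A1 K M - inv K * (inv 2 * (H1 K * H1 K) + inv 2 * H 2 K + ζpartial 2 M - H1 K * inv K)
formula₁ k M = combine₃ (- 1ℚ) (- (c * inv 2)) (c * c)
  (identity (seriesPartial (eSym 1) K M) (seriesPartial A1 K M) (hSym 2 K) (hSym 1 K) (H1 K) (H 2 K) (H 2 M) c)
  (seriesPartial-scale {A1} {eSym 1} 1ℚ K M (λ n → trans (sym (eSym-1 n)) (sym (*-identityˡ _)))) (hSym-2 K) (hSym-1 K)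
  where
  K = suc k
  c = inv K
  identity : ∀ S S′ h₂ h₁ h H₂ Z c → (S - c * (h₂ - h₁ * c + Z)) - (S′ - c * (inv 2 * (h * h) + inv 2 * H₂ + Z - h * c))
             ≡ - 1ℚ * (S′ - 1ℚ * S) + - (c * inv 2) * (ℕ→ℚ 2 * h₂ - (h * h + H₂)) + c * c * (h₁ - h)
  identity = solve-∀ ℚ-ring

formula₂ : ∀ k M → let K = suc k ; c = inv K in
  ℕ→ℚ 2 * (seriesPartial (eSym 2) K M - c * (hSym 3 K - hSym 2 K * c + H 3 M))
  ≡ seriesPartial A2 K M - inv K * (ℕ→ℚ 2 * ζpartial 3 M
                 + inv 3 * (H1 K * H1 K * H1 K + ℕ→ℚ 3 * H1 K * H 2 K + ℕ→ℚ 2 * H 3 K)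
                 - (H1 K * H1 K + H 2 K) * inv K)
formula₂ k M = combine₃ (- 1ℚ) (- (c * inv 3)) (c * c)
  (identity (seriesPartial (eSym 2) K M) (seriesPartial A2 K M) (hSym 3 K) (hSym 2 K) (Z₃ K) (Z₂ K) (H 3 M) c)
  (seriesPartial-scale {A2} {eSym 2} (ℕ→ℚ 2) K M (λ n → sym (eSym-2 n))) (hSym-3 K) (hSym-2 K)
  where
  K = suc k
  c = inv K
  identity : ∀ S S′ h₃ h₂ z₃ z₂ Z c → ℕ→ℚ 2 * (S - c * (h₃ - h₂ * c + Z)) - (S′ - c * (ℕ→ℚ 2 * Z + inv 3 * z₃ - z₂ * c))
             ≡ - 1ℚ * (S′ - ℕ→ℚ 2 * S) + - (c * inv 3) * (ℕ→ℚ 6 * h₃ - z₃) + c * c * (ℕ→ℚ 2 * h₂ - z₂)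
  identity = solve-∀ ℚ-ring

formula₃ : ∀ k M → let K = suc k ; c = inv K in
  ℕ→ℚ 6 * (seriesPartial (eSym 3) K M - c * (hSym 4 K - hSym 3 K * c + H 4 M))
  ≡ seriesPartial A3 K M - inv K * (inv 4 * (H1 K * H1 K * H1 K * H1 K + ℕ→ℚ 8 * H1 K * H 3 K
                          + ℕ→ℚ 6 * (H1 K * H1 K) * H 2 K + ℕ→ℚ 3 * (H 2 K * H 2 K)
                          + ℕ→ℚ 6 * H 4 K)
                 - (H1 K * H1 K * H1 K + ℕ→ℚ 3 * H1 K * H 2 K + ℕ→ℚ 2 * H 3 K) * inv K
                 + ℕ→ℚ 6 * ζpartial 4 M)
formula₃ k M = combine₃ (- 1ℚ) (- (c * inv 4)) (c * c)
  (identity (seriesPartial (eSym 3) K M) (seriesPartial A3 K M) (hSym 4 K) (hSym 3 K) (Z₄ K) (Z₃ K) (H 4 M) c)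
  (seriesPartial-scale {A3} {eSym 3} (ℕ→ℚ 6) K M (λ n → sym (eSym-3 n))) (hSym-4 K) (hSym-3 K)
  where
  K = suc k
  c = inv K
  identity : ∀ S S′ h₄ h₃ z₄ z₃ Z c → ℕ→ℚ 6 * (S - c * (h₄ - h₃ * c + Z)) - (S′ - c * (inv 4 * z₄ - z₃ * c + ℕ→ℚ 6 * Z))
             ≡ - 1ℚ * (S′ - ℕ→ℚ 6 * S) + - (c * inv 4) * (ℕ→ℚ 24 * h₄ - z₄) + c * c * (ℕ→ℚ 6 * h₃ - z₃)
  identity = solve-∀ ℚ-ring

corollary2p5 : (k : ℕ) → let K = suc k in
    TendsToZero (λ M → seriesPartial A1 K M
      - inv K * (inv 2 * (H1 K * H1 K) + inv 2 * H 2 K + ζpartial 2 M - H1 K * inv K))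
    × TendsToZero (λ M → seriesPartial A2 K M
      - inv K * (ℕ→ℚ 2 * ζpartial 3 M
                 + inv 3 * (H1 K * H1 K * H1 K + ℕ→ℚ 3 * H1 K * H 2 K + ℕ→ℚ 2 * H 3 K)
                 - (H1 K * H1 K + H 2 K) * inv K))
    × TendsToZero (λ M → seriesPartial A3 K M
      - inv K * (inv 4 * (H1 K * H1 K * H1 K * H1 K + ℕ→ℚ 8 * H1 K * H 3 K
                          + ℕ→ℚ 6 * (H1 K * H1 K) * H 2 K + ℕ→ℚ 3 * (H 2 K * H 2 K)
                          + ℕ→ℚ 6 * H 4 K)
                 - (H1 K * H1 K * H1 K + ℕ→ℚ 3 * H1 K * H 2 K + ℕ→ℚ 2 * H 3 K) * inv K
                 + ℕ→ℚ 6 * ζpartial 4 M))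
corollary2p5 k =
    null-cong (formula₁ k) (series-limit 0 k ℕ.z≤n)
  , null-cong (formula₂ k) (null-scaleℕ 2 (series-limit 1 k (ℕ.s≤s ℕ.z≤n)))
  , null-cong (formula₃ k) (null-scaleℕ 6 (series-limit 2 k (ℕ.s≤s (ℕ.s≤s ℕ.z≤n))))
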